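{- Let $\mathcal A=(\mathbb Q,\delta,q_0,f_0)$ be a Nested Data Class Memory Automaton of level $\ell$ with $f_0(d)=\mathfrak f$ for all data values $d$. Then the $\pi$-term $\mathcal P[\mathcal A]$ is typably hierarchical, i.e. there is a finite forest $\mathcal T$ of base types containing $t_r$ and the $t_{c^i_q}$ such that $\mathrm{nf}(\mathcal P[\mathcal A])$ is $\mathcal T$-shaped and $\Gamma\vdash\mathrm{nf}(\mathcal P[\mathcal A])$ for some $\mathrm{nf}(\mathcal P[\mathcal A])$-safe environment $\Gamma$.
   Context: \textbf{NDCMA.} A nested dataset of level $\ell$: infinitely many trees of height $\ell$ (parent map $\mathrm{pred}$), each data value of level $<\ell$ having infinitely many children. $\mathfrak f$ a special "fresh" symbol, $\mathbb Q_{\mathfrak f}=\mathbb Q\cup\{\mathfrak f\}$. An NDCMA of level $\ell$ is $(\mathbb Q,\delta,q_0,f_0)$ with $\mathbb Q$ finite, $q_0\in\mathbb Q$, $f_0:\mathcal D\to\mathbb Q_{\mathfrak f}$ a class memory function, $\delta=\bigcup_{i=1}^\ell\delta_i$, $\delta_i\subseteq\mathbb Q\times\mathbb Q_{\mathfrak f}^i\times\mathbb Q\times\mathbb Q^i$. Every transition is (as observed in the paper) of the form $(q_0,q_1,\dots,q_j,\mathfrak f,\dots,\mathfrak f,q'_0,\dots,q'_i)$ ($i-j$ copies of $\mathfrak f$, $q_0,\dots,q_j\in\mathbb Q$, $0\le j\le i$); $\theta_j$ is the set of such transitions with that $j$. \textbf{Encoding.} Names $c^i_q$ ($q\in\mathbb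 Q$, $0\le i\le\ell$), $\mathcal C^i=\{c^i_q\mid q\in\mathbb Q\}$, plus one global free name $r$. Each $c^i_q$ is restricted with annotation $t_{c^i_q}[t_r]$, where $t_{c^i_q}$ and $t_r$ are base types; $c.P$ abbreviates $c(x).P$ with $x$ not free in $P$, and $\overline c.Q$ abbreviates $\overline c\langle r\rangle.Q$ ($\overline c$ alone: continuation $\mathbf 0$). For $tr=(q_0,\dots,q_j,\mathfrak f,\dots,\mathfrak f,q'_0,\dots,q'_i)\in\theta_j$: $A_{tr}=c^0_{q_0}.\cdots.c^j_{q_j}.\nu\mathcal C^{j+1}.\cdots\nu\mathcal C^i.\big(\prod_{k=0}^i\overline{c^k_{q'_k}}\parallel\prod_{k=j+1}^iP_{\theta_k}\big)$ with $P_{\theta_j}=\prod_{tr\in\theta_j}!(A_{tr})$ (empty product $\mathbf 0$). $\mathcal P[\mathcal A]=\nu\mathcal C^0.(P_{\theta_0}\parallel\overline{c^0_{q_0}})$. \textbf{$\pi$-calculus.} Terms $P ::= \nu x.P \mid P_1\parallel P_2 \mid M \mid\, !M$, $M ::= \mathbf 0 \mid M+M \mid \pi.P$, $\pi ::= a(x)\mid \overline a\langle b\rangle \mid \tau$; $\mathrm{fn}$, $\mathrm{bn}_\nu$ free and restriction-bound names; $M$, $!M$ sequential. $\equiv$: smallest congruence containing $\alpha$-conversion, comm./assoc. of $+$, $\parallel$ with neutral $\mathbf 0$, $\nu x.\mathbf 0\equiv\mathbf 0$, $\nu x\nu y.P\equiv\nu y\nu x.P$, $!\mathbf 0\equiv\mathbf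 0$, $!M\equiv M\parallel!M$, $P\parallel\nu a.Q\equiv\nu a.(P\parallel Q)$ if $a\notin\mathrm{fn}(P)$. Normal forms $\nu X.\prod_iA_i$, each $A_i$ being $\sum_j\pi_j.N_j$ or $!(\sum_j\pi_j.N_j)$, $N_j$ normal forms, names bound at most once, free/bound disjoint. $\mathrm{nf}$: $\mathrm{nf}(\mathbf 0)=\mathbf 0$, $\mathrm{nf}(\pi.P)=\pi.\mathrm{nf}(P)$, $\mathrm{nf}(\nu x.P)=\nu x.\mathrm{nf}(P)$, $\mathrm{nf}(M+M')$ drops $\mathbf 0$ summands, $\mathrm{nf}(!M)=!\mathrm{nf}(M)$ or $\mathbf 0$, $\mathrm{nf}(P\parallel Q)=\nu X_PX_Q.(N_P\parallel N_Q)$ where $\mathrm{nf}(P)=\nu X_P.N_P$, $\mathrm{nf}(Q)=\nu X_Q.N_Q$ (dropping $\mathbf 0$ components), with bound names renamed apart. \textbf{Types, forests.} $(\mathcal T,\lessdot)$ a finite forest of base types, $<,\le$ its closures; $\tau::=t\mid t[\tau]$, $\mathrm{base}(t)=\mathrm{base}(t[\tau])=t$; annotated terms have restrictions $\nu(x{:}\tau)$. $\mathrm{forest}$: $\nu(x{:}\tau).Q\mapsto$ root labelled $(x,\mathrm{base}(\tau))$ above the roots of $\mathrm{forest}(Q)$; $\parallel\mapsto$ disjoint union; sequential $Q\mapsto$ single node labelled $Q$; $\mathbf 0\mapsto$ empty. A forest is $\mathcal T$-compatible if along every path $n_1\cdots n_kn$ (parent to child) with $n$ labelled by a sequential term and $n_i$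 labelled $(x_i,t_i)$, $t_1<\cdots<t_k$; $P$ is $\mathcal T$-compatible if $\mathrm{forest}(Q)$ is for some $Q\equiv P$; $\mathcal T$-shaped if all subterms are $\mathcal T$-compatible. \textbf{Tied-to.} For $P=\nu X.\prod_iA_i$: $i$ linked to $j$ if $\mathrm{fn}(A_i)\cap\mathrm{fn}(A_j)$ contains a name restricted in $X$; tied-to its transitive closure; $y$ tied to $A_i$ if $y\in\mathrm{fn}(A_j)$ for some $j$ tied to $i$; in $a(y).P$, $A_i$ is migratable if $y$ is tied to $A_i$ in $P$. \textbf{Type system.} Environments: finite partial maps names$\to$types; $\Gamma,X$ extension; $\Gamma(Y)=\{\Gamma(y)\mid y\in Y\cap\mathrm{dom}\Gamma\}$; base elementwise; $S<t$ means all $s\in S$ have $s<t$. (Par) $\Gamma\vdash\nu X.\prod_iA_i$ if $\Gamma,X\vdash A_i$ for all $i$ and for all $i$, $(x{:}\tau_x)\in X$ with $x$ tied to $A_i$: $\mathrm{base}(\Gamma(\mathrm{fn}(A_i)))<\mathrm{base}(\tau_x)$; (Choice) $\Gamma\vdash\sum_i\pi_i.P_i$ if each $\Gamma\vdash\pi_i.P_i$; (Repl) $\Gamma\vdash!A$ if $\Gamma\vdash A$; (Tau) $\Gamma\vdash\tau.P$ if $\Gamma\vdash P$; (Out) $\Gamma\vdash\overline a\langle b\rangle.Q$ if $\Gamma(a)=t_a[\tau_b]$, $\Gamma(b)=\tau_b$, $\Gamma\vdash Q$; (In) $\Gamma\vdash a(x).\nu X.\prod_iA_i$ if $\Gamma(a)=t_a[\tau_x]$,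 $\Gamma,x{:}\tau_x\vdash\nu X.\prod_iA_i$, and either $\mathrm{base}(\tau_x)\le t_a$ or each migratable $A_i$ has $\mathrm{base}(\Gamma(\mathrm{fn}(A_i)\setminus\{a\}))<t_a$. $\Gamma$ is $P$-safe if $\mathrm{base}(\Gamma(x))<\mathrm{base}(\tau)$ for all $x\in\mathrm{fn}(P)$ and $(y{:}\tau)\in\mathrm{bn}_\nu(P)$. -}

module Defs where

open import Data.Nat using (ℕ; zero; suc; _+_; _*_; _∸_; _≤_; _⊔_)
open import Data.Nat.Properties using (_≟_)
open import Data.Fin using (Fin; toℕ)
open import Data.Vec using (Vec; toList; []; _∷_)
open import Data.List using (List; []; _∷_; _++_; map; filter; allFin; upTo; length; lookup; foldr)
open import Data.List.Membership.Propositional using (_∈_; _∉_)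
import Data.List.Membership.DecPropositional
import Data.Product
open import Data.List.Relation.Unary.Linked using (Linked)
open import Data.Maybe using (Maybe; just; nothing)
open import Data.Product using (Σ; ∃; _×_; _,_; proj₁)
open import Data.Sum using (_⊎_)
open import Data.Bool using (if_then_else_)
open import Relation.Nullary using (¬_; does)
open import Relation.Nullary.Decidable using (¬?)
open import Relation.Binary.PropositionalEquality using (_≡_)
open import Relation.Binary.Construct.Closure.Transitive using (TransClosure)

-- A nested dataset of level ℓ, concretely: a data value of level k ≤ ℓ is
-- a path (n₀, …, n_k) of naturals; pred drops the last entry.  This gives
-- infinitely many trees of height ℓ in which every value of level < ℓ has
-- infinitely many children.  (Only used as the domain of f₀.)
DataValue : ℕ → Set
DataValue ℓ = Σ (List ℕ) λ l → 1 ≤ length l × length l ≤ suc ℓ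

-- A transition in δ_i, written in the shape
--   (q₀, q₁, …, q_j, 𝔣, …, 𝔣, q'₀, …, q'_i)   (i - j copies of 𝔣)
-- with 1 ≤ i ≤ ℓ, 0 ≤ j ≤ i.  src = (q₀,…,q_j), tgt = (q'₀,…,q'_i).
record Trans (n ℓ : ℕ) : Set where
  field
    i   : ℕ
    1≤i : 1 ≤ i
    i≤ℓ : i ≤ ℓ
    j   : ℕ
    j≤i : j ≤ i
    src : Vec (Fin n) (suc j)
    tgt : Vec (Fin n) (suc i)

-- NDCMA (ℚ, δ, q₀, f₀) of level ℓ, ℚ = Fin n, ℚ_𝔣 = Maybe (Fin n)
-- (nothing = the fresh symbol 𝔣); δ = ⋃ δ_i given as a finite list.
record NDCMA (ℓ : ℕ) : Set where
  field
    n  : ℕ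
    δ  : List (Trans n ℓ)
    q₀ : Fin n
    f₀ : DataValue ℓ → Maybe (Fin n)

Name : Set
Name = ℕ

data BT (n : ℕ) : Set where
  t-r     : BT n
  t-c     : ℕ → Fin n → BT n
  t-other : ℕ → BT n

data Ty (n : ℕ) : Set where
  base  : BT n → Ty n
  _⟦_⟧  : BT n → Ty n → Ty n

baseOf : ∀ {n} → Ty n → BT n
baseOf (base t)  = t
baseOf (t ⟦ _ ⟧) = t

ParentRel : ∀ {n} → (BT n → Maybe (BT n)) → BT n → BT n → Set
ParentRel p s t = p t ≡ just s

record Forest (n : ℕ) : Set where
  field
    parent  : BT n → Maybe (BT n)
    nodes   : List (BT n)
    closed  : ∀ s t → ParentRel parent s t → s ∈ nodes × t ∈ nodes
    acyclic : ∀ t → ¬ TransClosure (ParentRel parent) t t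

module _ {n : ℕ} (𝒯 : Forest n) where
  open Forest 𝒯
  _<ᵀ_ : BT n → BT n → Set
  _<ᵀ_ = TransClosure (ParentRel parent)

  _≤ᵀ_ : BT n → BT n → Set
  s ≤ᵀ t = s ≡ t ⊎ s <ᵀ t

  TyIn : Ty n → Set
  TyIn (base t)  = t ∈ nodes
  TyIn (t ⟦ τ ⟧) = t ∈ nodes × TyIn τ

data Act : Set where
  inp : Name → Name → Act
  out : Name → Name → Act
  tau : Act

data Proc (n : ℕ) : Set
data Seq (n : ℕ) : Set

data Proc n where
  ν    : Name → Ty n → Proc n → Proc n
  _∥_  : Proc n → Proc n → Proc n
  seq  : Seq n → Proc n
  bang : Seq n → Proc n

data Seq n where
  𝟘   : Seq n
  _⊕_ : Seq n → Seq n → Seq n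
  _∙_ : Act → Proc n → Seq n

remove : Name → List Name → List Name
remove x = filter (λ y → ¬? (y ≟ x))

fnP : ∀ {n} → Proc n → List Name
fnM : ∀ {n} → Seq n → List Name
fnP (ν x τ P) = remove x (fnP P)
fnP (P ∥ Q)   = fnP P ++ fnP Q
fnP (seq M)   = fnM M
fnP (bang M)  = fnM M
fnM 𝟘               = []
fnM (M ⊕ M')        = fnM M ++ fnM M'
fnM (inp a x ∙ P)   = a ∷ remove x (fnP P)
fnM (out a b ∙ P)   = a ∷ b ∷ fnP P
fnM (tau ∙ P)       = fnP P

namesP : ∀ {n} → Proc n → List Name
namesM : ∀ {n} → Seq n → List Name
namesP (ν x τ P) = x ∷ namesP P
namesP (P ∥ Q)   = namesP P ++ namesP Q
namesP (seq M)   = namesM M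
namesP (bang M)  = namesM M
namesM 𝟘             = []
namesM (M ⊕ M')      = namesM M ++ namesM M'
namesM (inp a x ∙ P) = a ∷ x ∷ namesP P
namesM (out a b ∙ P) = a ∷ b ∷ namesP P
namesM (tau ∙ P)     = namesP P

renN : Name → Name → Name → Name
renN x y z = if does (z ≟ x) then y else z

renP : ∀ {n} → Name → Name → Proc n → Proc n
renM : ∀ {n} → Name → Name → Seq n → Seq n
renP x y (ν z τ P) = if does (z ≟ x) then ν z τ P else ν z τ (renP x y P)
renP x y (P ∥ Q)   = renP x y P ∥ renP x y Q
renP x y (seq M)   = seq (renM x y M)
renP x y (bang M)  = bang (renM x y M)
renM x y 𝟘             = 𝟘
renM x y (M ⊕ M')      = renM x y M ⊕ renM x y M'
renM x y (inp a z ∙ P) =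
  inp (renN x y a) z ∙ (if does (z ≟ x) then P else renP x y P)
renM x y (out a b ∙ P) = out (renN x y a) (renN x y b) ∙ renP x y P
renM x y (tau ∙ P)     = tau ∙ renP x y P

infix 4 _≡P_ _≡M_
data _≡P_ {n : ℕ} : Proc n → Proc n → Set
data _≡M_ {n : ℕ} : Seq n → Seq n → Set

data _≡P_ {n} where
  reflP   : ∀ {P} → P ≡P P
  symP    : ∀ {P Q} → P ≡P Q → Q ≡P P
  transP  : ∀ {P Q R} → P ≡P Q → Q ≡P R → P ≡P R
  cong-ν  : ∀ {x τ P Q} → P ≡P Q → ν x τ P ≡P ν x τ Q
  cong-∥  : ∀ {P P' Q Q'} → P ≡P P' → Q ≡P Q' → (P ∥ Q) ≡P (P' ∥ Q')
  cong-seq  : ∀ {M M'} → M ≡M M' → seq M ≡P seq M'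
  cong-bang : ∀ {M M'} → M ≡M M' → bang M ≡P bang M'
  α-ν     : ∀ {x y τ P} → y ∉ namesP P → ν x τ P ≡P ν y τ (renP x y P)
  ∥-comm  : ∀ {P Q} → (P ∥ Q) ≡P (Q ∥ P)
  ∥-assoc : ∀ {P Q R} → ((P ∥ Q) ∥ R) ≡P (P ∥ (Q ∥ R))
  ∥-unit  : ∀ {P} → (P ∥ seq 𝟘) ≡P P
  ν-zero  : ∀ {x τ} → ν x τ (seq 𝟘) ≡P seq 𝟘
  ν-swap  : ∀ {x τ y σ P} → ν x τ (ν y σ P) ≡P ν y σ (ν x τ P)
  bang-zero   : bang 𝟘 ≡P seq 𝟘
  bang-unfold : ∀ {M} → bang M ≡P (seq M ∥ bang M)
  extrusion   : ∀ {P a τ Q} → a ∉ fnP P → (P ∥ ν a τ Q) ≡P ν a τ (P ∥ Q)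

data _≡M_ {n} where
  reflM   : ∀ {M} → M ≡M M
  symM    : ∀ {M M'} → M ≡M M' → M' ≡M M
  transM  : ∀ {M M' M''} → M ≡M M' → M' ≡M M'' → M ≡M M''
  cong-⊕  : ∀ {M M' N N'} → M ≡M M' → N ≡M N' → (M ⊕ N) ≡M (M' ⊕ N')
  cong-∙  : ∀ {π P Q} → P ≡P Q → (π ∙ P) ≡M (π ∙ Q)
  α-inp   : ∀ {a x y P} → y ∉ namesP P → (inp a x ∙ P) ≡M (inp a y ∙ renP x y P)
  ⊕-comm  : ∀ {M N} → (M ⊕ N) ≡M (N ⊕ M)
  ⊕-assoc : ∀ {M N O} → ((M ⊕ N) ⊕ O) ≡M (M ⊕ (N ⊕ O))
  ⊕-unit  : ∀ {M} → (M ⊕ 𝟘) ≡M M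

data Tree (n : ℕ) : Set where
  νnode : Name → BT n → List (Tree n) → Tree n
  leaf  : Proc n → Tree n

forestP : ∀ {n} → Proc n → List (Tree n)
forestP (ν x τ P)        = νnode x (baseOf τ) (forestP P) ∷ []
forestP (P ∥ Q)          = forestP P ++ forestP Q
forestP (seq 𝟘)          = []
forestP (seq (M ⊕ M'))   = leaf (seq (M ⊕ M')) ∷ []
forestP (seq (π ∙ P))    = leaf (seq (π ∙ P)) ∷ []
forestP (bang M)         = leaf (bang M) ∷ []

data PathT {n : ℕ} : Tree n → List (BT n) → Proc n → Set
data PathF {n : ℕ} : List (Tree n) → List (BT n) → Proc n → Set
data PathT {n} where
  atLeaf : ∀ {Q} → PathT (leaf Q) [] Q
  down   : ∀ {x t ch ts Q} → PathF ch ts Q → PathT (νnode x t ch) (t ∷ ts) Q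
data PathF {n} where
  pick : ∀ {F T ts Q} → T ∈ F → PathT T ts Q → PathF F ts Q

module _ {n : ℕ} (𝒯 : Forest n) where
  CompatibleForest : List (Tree n) → Set
  CompatibleForest F = ∀ ts Q → PathF F ts Q → Linked (_<ᵀ_ 𝒯) ts

  Compatible : Proc n → Set
  Compatible P = ∃ λ Q → Q ≡P P × CompatibleForest (forestP Q)

data SubP {n : ℕ} : Proc n → Proc n → Set
data SubM {n : ℕ} : Proc n → Seq n → Set
data SubP {n} where
  sub-refl : ∀ {P} → SubP P P
  sub-ν    : ∀ {Q x τ P} → SubP Q P → SubP Q (ν x τ P)
  sub-∥ˡ   : ∀ {Q P P'} → SubP Q P → SubP Q (P ∥ P')
  sub-∥ʳ   : ∀ {Q P P'} → SubP Q P' → SubP Q (P ∥ P')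
  sub-seq  : ∀ {Q M} → SubM Q M → SubP Q (seq M)
  sub-bang : ∀ {Q M} → SubM Q M → SubP Q (bang M)
data SubM {n} where
  subM-self : ∀ {M} → SubM (seq M) M
  subM-⊕ˡ   : ∀ {Q M M'} → SubM Q M → SubM Q (M ⊕ M')
  subM-⊕ʳ   : ∀ {Q M M'} → SubM Q M' → SubM Q (M ⊕ M')
  subM-∙    : ∀ {Q π P} → SubP Q P → SubM Q (π ∙ P)

Shaped : ∀ {n} → Forest n → Proc n → Set
Shaped 𝒯 P = ∀ Q → SubP Q P → Compatible 𝒯 Q

data NF (n : ℕ) : Set
data Comp (n : ℕ) : Set
data Branch (n : ℕ) : Set
data NF n where
  ν⟨_⟩∏_ : List (Name × Ty n) → List (Comp n) → NF n
data Comp n where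
  sumC : List (Branch n) → Comp n
  repC : List (Branch n) → Comp n
data Branch n where
  _·_ : Act → NF n → Branch n

toProc  : ∀ {n} → NF n → Proc n
prodC   : ∀ {n} → List (Comp n) → Proc n
compP   : ∀ {n} → Comp n → Proc n
sumB    : ∀ {n} → List (Branch n) → Seq n
branchM : ∀ {n} → Branch n → Seq n
toProc (ν⟨ X ⟩∏ As) = foldr (λ xτ P → ν (proj₁ xτ) (Data.Product.proj₂ xτ) P) (prodC As) X
prodC []             = seq 𝟘
prodC (A ∷ [])       = compP A
prodC (A ∷ A' ∷ As)  = compP A ∥ prodC (A' ∷ As)
compP (sumC bs) = seq (sumB bs)
compP (repC bs) = bang (sumB bs)
sumB []            = 𝟘
sumB (b ∷ [])      = branchM b
sumB (b ∷ b' ∷ bs) = branchM b ⊕ sumB (b' ∷ bs)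
branchM (π · N) = π ∙ toProc N

-- nf, renaming every bound name to a globally fresh one (so names are bound
-- at most once and free/bound names are disjoint).  ρ renames the names in
-- scope, k is the next fresh name.
upd : (Name → Name) → Name → Name → (Name → Name)
upd ρ x k z = if does (z ≟ x) then k else ρ z

nfP : ∀ {n} → (Name → Name) → ℕ → Proc n → NF n × ℕ
nfM : ∀ {n} → (Name → Name) → ℕ → Seq n → List (Branch n) × ℕ
nfP ρ k (ν x τ P) with nfP (upd ρ x k) (suc k) P
... | ν⟨ X ⟩∏ As , k' = ν⟨ (k , τ) ∷ X ⟩∏ As , k'
nfP ρ k (P ∥ Q) with nfP ρ k P
... | ν⟨ X ⟩∏ As , k' with nfP ρ k' Q
... | ν⟨ Y ⟩∏ Bs , k'' = ν⟨ X ++ Y ⟩∏ (As ++ Bs) , k''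
nfP ρ k (seq M) with nfM ρ k M
... | [] , k'     = ν⟨ [] ⟩∏ [] , k'
... | b ∷ bs , k' = ν⟨ [] ⟩∏ (sumC (b ∷ bs) ∷ []) , k'
nfP ρ k (bang M) with nfM ρ k M
... | [] , k'     = ν⟨ [] ⟩∏ [] , k'
... | b ∷ bs , k' = ν⟨ [] ⟩∏ (repC (b ∷ bs) ∷ []) , k'
nfM ρ k 𝟘 = [] , k
nfM ρ k (M ⊕ M') with nfM ρ k M
... | bs , k' with nfM ρ k' M'
... | bs' , k'' = bs ++ bs' , k''
nfM ρ k (inp a x ∙ P) with nfP (upd ρ x k) (suc k) P
... | N , k' = (inp (ρ a) k · N) ∷ [] , k'
nfM ρ k (out a b ∙ P) with nfP ρ k P
... | N , k' = (out (ρ a) (ρ b) · N) ∷ [] , k'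
nfM ρ k (tau ∙ P) with nfP ρ k P
... | N , k' = (tau · N) ∷ [] , k'

nf : ∀ {n} → Proc n → NF n
nf P = proj₁ (nfP (λ z → z) (suc (foldr _⊔_ 0 (namesP P))) P)

fnN  : ∀ {n} → NF n → List Name
fnCs : ∀ {n} → List (Comp n) → List Name
fnC  : ∀ {n} → Comp n → List Name
fnBs : ∀ {n} → List (Branch n) → List Name
fnB  : ∀ {n} → Branch n → List Name
fnN (ν⟨ X ⟩∏ As) = filter (λ y → ¬? (Data.List.Membership.DecPropositional._∈?_ _≟_ y (map proj₁ X))) (fnCs As)
fnCs []       = []
fnCs (A ∷ As) = fnC A ++ fnCs As
fnC (sumC bs) = fnBs bs
fnC (repC bs) = fnBs bs
fnBs []       = []
fnBs (b ∷ bs) = fnB b ++ fnBs bs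
fnB (inp a x · N)  = a ∷ remove x (fnN N)
fnB (out a b · N)  = a ∷ b ∷ fnN N
fnB (tau · N)      = fnN N

bnN  : ∀ {n} → NF n → List (Name × Ty n)
bnCs : ∀ {n} → List (Comp n) → List (Name × Ty n)
bnBs : ∀ {n} → List (Branch n) → List (Name × Ty n)
bnN (ν⟨ X ⟩∏ As) = X ++ bnCs As
bnCs []              = []
bnCs (sumC bs ∷ As)  = bnBs bs ++ bnCs As
bnCs (repC bs ∷ As)  = bnBs bs ++ bnCs As
bnBs []              = []
bnBs ((π · N) ∷ bs)  = bnN N ++ bnBs bs

module _ {n : ℕ} (X : List (Name × Ty n)) (As : List (Comp n)) where
  LinkedTo : Fin (length As) → Fin (length As) → Set
  LinkedTo i j = ∃ λ y → y ∈ fnC (lookup As i) × y ∈ fnC (lookup As j) × y ∈ map proj₁ X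

  TiedTo : Fin (length As) → Fin (length As) → Set
  TiedTo = TransClosure LinkedTo

  NameTied : Name → Fin (length As) → Set
  NameTied y i = ∃ λ j → y ∈ fnC (lookup As j) × TiedTo j i

Env : ℕ → Set
Env n = List (Name × Ty n)     -- Γ,X is X ++ Γ

lookupEnv : ∀ {n} → Env n → Name → Maybe (Ty n)
lookupEnv [] y = nothing
lookupEnv ((x , τ) ∷ Γ) y = if does (y ≟ x) then just τ else lookupEnv Γ y

module _ {n : ℕ} (𝒯 : Forest n) where
  BasesBelow : Env n → List Name → BT n → Set
  BasesBelow Γ Y t = ∀ y σ → y ∈ Y → lookupEnv Γ y ≡ just σ → _<ᵀ_ 𝒯 (baseOf σ) t

  data _⊢N_ : Env n → NF n → Set
  data _⊢C_ : Env n → Comp n → Set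
  data _⊢B_ : Env n → Branch n → Set

  data _⊢N_ where
    Par : ∀ {Γ X As}
        → (∀ i → (X ++ Γ) ⊢C lookup As i)
        → (∀ i x τ → (x , τ) ∈ X → NameTied X As x i
             → BasesBelow Γ (fnC (lookup As i)) (baseOf τ))
        → Γ ⊢N (ν⟨ X ⟩∏ As)

  data _⊢C_ where
    Choice : ∀ {Γ bs} → (∀ b → b ∈ bs → Γ ⊢B b) → Γ ⊢C sumC bs
    Repl   : ∀ {Γ bs} → Γ ⊢C sumC bs → Γ ⊢C repC bs

  data _⊢B_ where
    Tau : ∀ {Γ N} → Γ ⊢N N → Γ ⊢B (tau · N)
    Out : ∀ {Γ a b ta τb N}
        → lookupEnv Γ a ≡ just (ta ⟦ τb ⟧) → lookupEnv Γ b ≡ just τb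
        → Γ ⊢N N → Γ ⊢B (out a b · N)
    In  : ∀ {Γ a x ta τx X As}
        → lookupEnv Γ a ≡ just (ta ⟦ τx ⟧)
        → ((x , τx) ∷ Γ) ⊢N (ν⟨ X ⟩∏ As)
        → (_≤ᵀ_ 𝒯 (baseOf τx) ta
           ⊎ (∀ i → NameTied X As x i
                → BasesBelow Γ (remove a (fnC (lookup As i))) ta))
        → Γ ⊢B (inp a x · (ν⟨ X ⟩∏ As))

  Safe : Env n → NF n → Set
  Safe Γ N = ∀ y τ → (y , τ) ∈ bnN N → BasesBelow Γ (fnN N) (baseOf τ)

  EnvOver : Env n → Set
  EnvOver Γ = ∀ x τ → (x , τ) ∈ Γ → TyIn 𝒯 τ

module Encoding {ℓ : ℕ} (𝒜 : NDCMA ℓ) where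
  open NDCMA 𝒜

  r : Name
  r = 0

  dummy : Name                  -- input variable of c.P = c(x).P
  dummy = 1

  c : ℕ → Fin n → Name          -- c^i_q (injective, distinct from r, dummy)
  c i q = 2 + (i * n + toℕ q)

  tyC : ℕ → Fin n → Ty n
  tyC i q = t-c i q ⟦ base t-r ⟧

  outbar : Name → Proc n        -- c̄ = c̄⟨r⟩.0
  outbar a = seq (out a r ∙ seq 𝟘)

  prod : List (Proc n) → Proc n
  prod []           = seq 𝟘
  prod (P ∷ [])     = P
  prod (P ∷ Q ∷ Ps) = P ∥ prod (Q ∷ Ps)

  νC : ℕ → Proc n → Proc n
  νC k P = foldr (λ q P' → ν (c k q) (tyC k q) P') P (allFin n)

  levels : ℕ → ℕ → List ℕ
  levels j i = map (λ m → suc (j + m)) (upTo (i ∸ j))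

  inpChain : ℕ → ∀ {m} → Vec (Fin n) (suc m) → Proc n → Seq n
  inpChain k (q ∷ [])      P = inp (c k q) dummy ∙ P
  inpChain k (q ∷ q' ∷ qs) P = inp (c k q) dummy ∙ seq (inpChain (suc k) (q' ∷ qs) P)

  outs : ℕ → List (Fin n) → List (Proc n)
  outs k []       = []
  outs k (q ∷ qs) = outbar (c k q) ∷ outs (suc k) qs

  -- P_{θ_k} and A_tr, with a fuel argument (fuel suc ℓ suffices since the
  -- level j strictly increases along nesting and is ≤ ℓ).
  Pθ     : ℕ → ℕ → Proc n
  bangs  : ℕ → List (Trans n ℓ) → List (Proc n)
  Atr    : ℕ → Trans n ℓ → Seq n
  Pθs    : ℕ → List ℕ → List (Proc n)
  Pθ zero    k = seq 𝟘
  Pθ (suc f) k = prod (bangs f (filter (λ tr → Trans.j tr ≟ k) δ))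
  bangs f []         = []
  bangs f (tr ∷ trs) = bang (Atr f tr) ∷ bangs f trs
  Atr f tr = inpChain 0 (Trans.src tr)
               (foldr νC
                  (prod (outs 0 (toList (Trans.tgt tr)))
                     ∥ prod (Pθs f (levels (Trans.j tr) (Trans.i tr))))
                  (levels (Trans.j tr) (Trans.i tr)))
  Pθs f []       = []
  Pθs f (k ∷ ks) = Pθ f k ∷ Pθs f ks

  𝒫 : Proc n
  𝒫 = νC 0 (Pθ (suc ℓ) 0 ∥ outbar (c 0 q₀))

  ContainsEncTypes : Forest n → Set
  ContainsEncTypes 𝒯 = t-r ∈ Forest.nodes 𝒯 × (∀ i q → i ≤ ℓ → t-c i q ∈ Forest.nodes 𝒯)

TypablyHierarchical : ∀ {ℓ} (𝒜 : NDCMA ℓ) → Set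
TypablyHierarchical 𝒜 =
  Σ (Forest n) λ 𝒯 →
      ContainsEncTypes 𝒯
    × Shaped 𝒯 (toProc (nf 𝒫))
    × Σ (Env n) λ Γ → EnvOver 𝒯 Γ × Safe 𝒯 Γ (nf 𝒫) × (_⊢N_ 𝒯 Γ (nf 𝒫))
  where open NDCMA 𝒜 using (n)
        open Encoding 𝒜

-- Number the names so that c^i_q precedes c^i'_q' whenever (i, q) is lexicographically smaller, and
-- take as forest of base types the single chain  t_r ⋖ t_{c^0_0} ⋖ ⋯ ⋖ t_{c^ℓ_{|Q|-1}}  in the same order.
-- In 𝒫[𝒜] the restrictions ν𝒞^{j+1} ⋯ ν𝒞^i of A_tr bind a block of consecutive names above every name
-- free beneath them (r and the names c^k_q, k ≤ j, bound further out), and nested restrictions bind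
-- increasing names.  Normalising such a stratified term keeps every restriction list a chain, which
-- gives 𝒯-shapedness, and keeps every free name of a component below every name restricted around it,
-- which gives (Par) whether or not the name is tied to the component.  Inputs bind a variable of the
-- root type t_r and outputs send r, so (Out) holds and (In) holds by its first alternative; since all
-- restricted types lie above t_r, the environment typing the free names with t_r is safe.

module Submission where

open import Defs
open import Data.Nat using (ℕ; zero; suc; _+_; _*_; _∸_; _≤_; _<_; z≤n; s≤s; s≤s⁻¹; _⊔_; pred; NonZero)
open import Data.Nat.DivMod using (_/_; _%_; m%n<n; m≡m%n+[m/n]*n; [m+kn]%n≡m%n; m<n⇒m%n≡m; m*n%n≡0; +-distrib-/; m*n/n≡m; m<n⇒m/n≡0)
open import Data.Fin as Fin using (Fin; zero; toℕ; fromℕ<)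
open import Data.Fin.Properties using (toℕ-fromℕ<; toℕ-injective; toℕ<n)
open import Data.Nat.Properties
open import Data.List using (List; []; _∷_; _++_; map; foldr; length; upTo; applyUpTo; tabulate; allFin)
open import Data.Vec using (Vec; toList) renaming ([] to []ᵥ; _∷_ to _∷ᵥ_)
open import Data.Vec.Properties using (length-toList)
open import Data.List.Properties using (map-++; ++-identityʳ; map-tabulate; map-upTo; foldr-++)
open import Data.List.Relation.Unary.All as All using (All; []; _∷_)
open import Data.List.Relation.Unary.All.Properties using (++⁺; map⁺; all-filter)
open import Data.List.Relation.Unary.Any using (here; there)
open import Data.List.Relation.Unary.Linked as Linked using (Linked; []; [-]; _∷_)
open import Data.List.Membership.Propositional using (_∈_; _∉_)
open import Data.List.Membership.Propositional.Properties using (∈-++⁺ˡ; ∈-++⁺ʳ; ∈-++⁻; ∈-filter⁺; ∈-filter⁻; ∈-lookup; ∈-map⁺; ∈-upTo⁺)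
open import Data.Product using (∃; _×_; _,_; proj₁; proj₂)
open import Data.Sum using (_⊎_; inj₁; inj₂; [_,_]′) renaming (map to ⊎-map; map₁ to ⊎-map₁)
open import Data.Empty using (⊥; ⊥-elim)
open import Data.Unit using (⊤; tt)
open import Data.Maybe using (Maybe; just; nothing)
open import Data.Maybe.Properties using (just-injective)
open import Function using (_∘_; id)
open import Data.Bool using (if_then_else_)
open import Relation.Nullary using (¬_; yes; no; does; contradiction)
open import Relation.Nullary.Decidable using (dec-true; dec-false)
open import Relation.Binary.Construct.Closure.Transitive using (TransClosure; [_]; _∷_; _∷ʳ_)
open import Relation.Binary.PropositionalEquality using (_≡_; refl; sym; trans; cong; cong₂; subst; subst₂; module ≡-Reasoning)

∈-remove⁺ : ∀ {y x} ys → y ∈ ys → ¬ y ≡ x → y ∈ remove x ys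
∈-remove⁺ ys = ∈-filter⁺ _

∈-remove⁻ : ∀ {y x} ys → y ∈ remove x ys → y ∈ ys × ¬ y ≡ x
∈-remove⁻ ys = ∈-filter⁻ _

if-≟-same : ∀ {A : Set} x (a b : A) → (if does (x ≟ x) then a else b) ≡ a
if-≟-same x a b rewrite dec-true (x ≟ x) refl = refl

if-≟-other : ∀ {A : Set} {y x} (a b : A) → ¬ y ≡ x → (if does (y ≟ x) then a else b) ≡ b
if-≟-other {y = y} {x} a b y≢x rewrite dec-false (y ≟ x) y≢x = refl

upd-same : ∀ ρ x k → upd ρ x k x ≡ k
upd-same ρ x k = if-≟-same x k (ρ x)

upd-other : ∀ ρ x k {z} → ¬ z ≡ x → upd ρ x k z ≡ ρ z
upd-other ρ x k = if-≟-other k _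

Image : (Name → Name) → List Name → Name → Set
Image ρ zs y = ∃ λ z → z ∈ zs × y ≡ ρ z

image-++⁺ : ∀ {ρ y} zs zs' → Image ρ zs y ⊎ Image ρ zs' y → Image ρ (zs ++ zs') y
image-++⁺ zs zs' (inj₁ (z , z∈ , eq)) = z , ∈-++⁺ˡ z∈ , eq
image-++⁺ zs zs' (inj₂ (z , z∈ , eq)) = z , ∈-++⁺ʳ zs z∈ , eq

∈⇒≤max : ∀ {x xs} → x ∈ xs → x ≤ foldr _⊔_ 0 xs
∈⇒≤max {xs = y ∷ ys} (here refl) = m≤m⊔n y (foldr _⊔_ 0 ys)
∈⇒≤max {xs = y ∷ ys} (there x∈) = ≤-trans (∈⇒≤max x∈) (m≤n⊔m y (foldr _⊔_ 0 ys))

module _ {n : ℕ} where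

  open ≡-Reasoning

  lookupEnv-here : ∀ (Γ : Env n) x τ → lookupEnv ((x , τ) ∷ Γ) x ≡ just τ
  lookupEnv-here Γ x τ = if-≟-same x (just τ) _

  lookupEnv-there : ∀ (Γ : Env n) x τ {y} → ¬ y ≡ x → lookupEnv ((x , τ) ∷ Γ) y ≡ lookupEnv Γ y
  lookupEnv-there Γ x τ = if-≟-other (just τ) _

  binders : NF n → List (Name × Ty n)
  binders (ν⟨ X ⟩∏ As) = X

  components : NF n → List (Comp n)
  components (ν⟨ X ⟩∏ As) = As

  boundNames : List (Name × Ty n) → List Name
  boundNames = map proj₁

  bases : List (Name × Ty n) → List (BT n)
  bases = map (baseOf ∘ proj₂)

  nfP-fresh : ∀ ρ k (P : Proc n) →
    k ≤ proj₂ (nfP ρ k P) × All ((k ≤_) ∘ proj₁) (binders (proj₁ (nfP ρ k P)))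
  nfM-fresh : ∀ ρ k (M : Seq n) → k ≤ proj₂ (nfM ρ k M)
  nfP-fresh ρ k (ν x τ P) with nfP (upd ρ x k) (suc k) P | nfP-fresh (upd ρ x k) (suc k) P
  ... | ν⟨ X ⟩∏ As , _ | k<k' , k<X = <⇒≤ k<k' , ≤-refl ∷ All.map <⇒≤ k<X
  nfP-fresh ρ k (P ∥ Q) with nfP ρ k P | nfP-fresh ρ k P
  ... | ν⟨ X ⟩∏ As , k' | k≤k' , k≤X with nfP ρ k' Q | nfP-fresh ρ k' Q
  ... | ν⟨ Y ⟩∏ Bs , _ | k'≤k'' , k'≤Y = ≤-trans k≤k' k'≤k'' , ++⁺ k≤X (All.map (≤-trans k≤k') k'≤Y)
  nfP-fresh ρ k (seq M) with nfM ρ k M | nfM-fresh ρ k M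
  ... | [] , _ | k≤k' = k≤k' , []
  ... | _ ∷ _ , _ | k≤k' = k≤k' , []
  nfP-fresh ρ k (bang M) with nfM ρ k M | nfM-fresh ρ k M
  ... | [] , _ | k≤k' = k≤k' , []
  ... | _ ∷ _ , _ | k≤k' = k≤k' , []
  nfM-fresh ρ k 𝟘 = ≤-refl
  nfM-fresh ρ k (M ⊕ M') with nfM ρ k M | nfM-fresh ρ k M
  ... | _ , k' | k≤k' with nfM ρ k' M' | nfM-fresh ρ k' M'
  ... | _ , _ | k'≤k'' = ≤-trans k≤k' k'≤k''
  nfM-fresh ρ k (inp a x ∙ P) = <⇒≤ (proj₁ (nfP-fresh (upd ρ x k) (suc k) P))
  nfM-fresh ρ k (out a b ∙ P) = proj₁ (nfP-fresh ρ k P)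
  nfM-fresh ρ k (tau ∙ P) = proj₁ (nfP-fresh ρ k P)

  ∈-fnCs-++⁻ : ∀ {y} (As Bs : List (Comp n)) → y ∈ fnCs (As ++ Bs) → y ∈ fnCs As ⊎ y ∈ fnCs Bs
  ∈-fnCs-++⁻ [] Bs y∈ = inj₂ y∈
  ∈-fnCs-++⁻ (A ∷ As) Bs y∈ with ∈-++⁻ (fnC A) y∈
  ... | inj₁ y∈A = inj₁ (∈-++⁺ˡ y∈A)
  ... | inj₂ y∈' = ⊎-map₁ (∈-++⁺ʳ (fnC A)) (∈-fnCs-++⁻ As Bs y∈')

  ∈-fnBs-++⁻ : ∀ {y} (bs bs' : List (Branch n)) → y ∈ fnBs (bs ++ bs') → y ∈ fnBs bs ⊎ y ∈ fnBs bs'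
  ∈-fnBs-++⁻ [] bs' y∈ = inj₂ y∈
  ∈-fnBs-++⁻ (b ∷ bs) bs' y∈ with ∈-++⁻ (fnB b) y∈
  ... | inj₁ y∈b = inj₁ (∈-++⁺ˡ y∈b)
  ... | inj₂ y∈' = ⊎-map₁ (∈-++⁺ʳ (fnB b)) (∈-fnBs-++⁻ bs bs' y∈')

  ∈-fnCs⁺ : ∀ {y A} (As : List (Comp n)) → A ∈ As → y ∈ fnC A → y ∈ fnCs As
  ∈-fnCs⁺ (A ∷ As) (here refl) y∈ = ∈-++⁺ˡ y∈
  ∈-fnCs⁺ (A' ∷ As) (there A∈) y∈ = ∈-++⁺ʳ (fnC A') (∈-fnCs⁺ As A∈ y∈)

  ∈-fnN⁻ : ∀ {y} X (As : List (Comp n)) → y ∈ fnN (ν⟨ X ⟩∏ As) → y ∈ fnCs As × y ∉ boundNames X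
  ∈-fnN⁻ X As = ∈-filter⁻ _

  nfP-free : ∀ ρ k (P : Proc n) {y} → y ∈ fnCs (components (proj₁ (nfP ρ k P)))
           → y ∈ boundNames (binders (proj₁ (nfP ρ k P))) ⊎ Image ρ (fnP P) y
  nfM-free : ∀ ρ k (M : Seq n) {y} → y ∈ fnBs (proj₁ (nfM ρ k M)) → Image ρ (fnM M) y
  nfP-free ρ k (ν x τ P) {y} with nfP (upd ρ x k) (suc k) P | nfP-free (upd ρ x k) (suc k) P
  ... | ν⟨ X ⟩∏ As , _ | ih = λ y∈ → unbind (ih y∈)
    where
    unbind : y ∈ boundNames X ⊎ Image (upd ρ x k) (fnP P) y
           → y ∈ boundNames ((k , τ) ∷ X) ⊎ Image ρ (remove x (fnP P)) y
    unbind (inj₁ y∈X) = inj₁ (there y∈X)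
    unbind (inj₂ (z , z∈ , y≡)) with z ≟ x
    ... | yes refl = inj₁ (here (trans y≡ (upd-same ρ z k)))
    ... | no z≢x = inj₂ (z , ∈-remove⁺ (fnP P) z∈ z≢x , trans y≡ (upd-other ρ x k z≢x))
  nfP-free ρ k (P ∥ Q) {y} with nfP ρ k P | nfP-free ρ k P
  ... | ν⟨ X ⟩∏ As , k' | ihP with nfP ρ k' Q | nfP-free ρ k' Q
  ... | ν⟨ Y ⟩∏ Bs , _ | ihQ = λ y∈ → [ left , right ]′ (∈-fnCs-++⁻ As Bs y∈)
    where
    left : y ∈ fnCs As → y ∈ boundNames (X ++ Y) ⊎ Image ρ (fnP P ++ fnP Q) y
    left y∈ = ⊎-map (λ y∈X → subst (y ∈_) (sym (map-++ proj₁ X Y)) (∈-++⁺ˡ y∈X))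
                    (λ im → image-++⁺ (fnP P) (fnP Q) (inj₁ im)) (ihP y∈)
    right : y ∈ fnCs Bs → y ∈ boundNames (X ++ Y) ⊎ Image ρ (fnP P ++ fnP Q) y
    right y∈ = ⊎-map (λ y∈Y → subst (y ∈_) (sym (map-++ proj₁ X Y)) (∈-++⁺ʳ (boundNames X) y∈Y))
                     (λ im → image-++⁺ (fnP P) (fnP Q) (inj₂ im)) (ihQ y∈)
  nfP-free ρ k (seq M) with nfM ρ k M | nfM-free ρ k M
  ... | [] , _ | _ = λ ()
  ... | b ∷ bs , _ | ih = λ y∈ → inj₂ (ih (subst (_ ∈_) (++-identityʳ _) y∈))
  nfP-free ρ k (bang M) with nfM ρ k M | nfM-free ρ k M
  ... | [] , _ | _ = λ ()
  ... | b ∷ bs , _ | ih = λ y∈ → inj₂ (ih (subst (_ ∈_) (++-identityʳ _) y∈))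
  nfM-free ρ k 𝟘 ()
  nfM-free ρ k (M ⊕ M') with nfM ρ k M | nfM-free ρ k M
  ... | bs , k' | ih with nfM ρ k' M' | nfM-free ρ k' M'
  ... | bs' , _ | ih' = λ y∈ → image-++⁺ (fnM M) (fnM M') (⊎-map ih ih' (∈-fnBs-++⁻ bs bs' y∈))
  nfM-free ρ k (inp a x ∙ P) {y} with nfP (upd ρ x k) (suc k) P | nfP-free (upd ρ x k) (suc k) P
  ... | ν⟨ X ⟩∏ As , _ | ih = λ y∈ → free (subst (y ∈_) (++-identityʳ _) y∈)
    where
    free : y ∈ ρ a ∷ remove k (fnN (ν⟨ X ⟩∏ As)) → Image ρ (a ∷ remove x (fnP P)) y
    free (here y≡) = a , here refl , y≡
    free (there y∈) with ∈-remove⁻ _ y∈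
    ... | y∈N , y≢k with ∈-fnN⁻ X As y∈N
    ... | y∈As , y∉X with ih y∈As
    ... | inj₁ y∈X = contradiction y∈X y∉X
    ... | inj₂ (z , z∈ , y≡) with z ≟ x
    ... | yes refl = contradiction (trans y≡ (upd-same ρ z k)) y≢k
    ... | no z≢x = z , there (∈-remove⁺ (fnP P) z∈ z≢x) , trans y≡ (upd-other ρ x k z≢x)
  nfM-free ρ k (out a b ∙ P) {y} with nfP ρ k P | nfP-free ρ k P
  ... | ν⟨ X ⟩∏ As , _ | ih = λ y∈ → free (subst (y ∈_) (++-identityʳ _) y∈)
    where
    free : y ∈ ρ a ∷ ρ b ∷ fnN (ν⟨ X ⟩∏ As) → Image ρ (a ∷ b ∷ fnP P) y
    free (here y≡) = a , here refl , y≡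
    free (there (here y≡)) = b , there (here refl) , y≡
    free (there (there y∈)) with ∈-fnN⁻ X As y∈
    ... | y∈As , y∉X with ih y∈As
    ... | inj₁ y∈X = contradiction y∈X y∉X
    ... | inj₂ (z , z∈ , y≡) = z , there (there z∈) , y≡
  nfM-free ρ k (tau ∙ P) {y} with nfP ρ k P | nfP-free ρ k P
  ... | ν⟨ X ⟩∏ As , _ | ih = λ y∈ → free (subst (y ∈_) (++-identityʳ _) y∈)
    where
    free : y ∈ fnN (ν⟨ X ⟩∏ As) → Image ρ (fnP P) y
    free y∈ with ∈-fnN⁻ X As y∈
    ... | y∈As , y∉X with ih y∈As
    ... | inj₁ y∈X = contradiction y∈X y∉X
    ... | inj₂ im = im

  infix 4 _≈ᴱ_
  record _≈ᴱ_ (Γ Γ' : Env n) : Set where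
    constructor lookup-≗
    field lookup-≡ : ∀ y → lookupEnv Γ y ≡ lookupEnv Γ' y
  open _≈ᴱ_ public

  ≈ᴱ-∷ : ∀ {Γ Γ'} x τ → Γ ≈ᴱ Γ' → (x , τ) ∷ Γ ≈ᴱ (x , τ) ∷ Γ'
  ≈ᴱ-∷ x τ Γ≈Γ' = lookup-≗ λ y → cong (if does (y ≟ x) then just τ else_) (lookup-≡ Γ≈Γ' y)

  ≈ᴱ-++ : ∀ {Γ Γ'} X → Γ ≈ᴱ Γ' → X ++ Γ ≈ᴱ X ++ Γ'
  ≈ᴱ-++ [] Γ≈Γ' = Γ≈Γ'
  ≈ᴱ-++ ((x , τ) ∷ X) Γ≈Γ' = ≈ᴱ-∷ x τ (≈ᴱ-++ X Γ≈Γ')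

  ≈ᴱ-trans : ∀ {Γ Γ' Γ''} → Γ ≈ᴱ Γ' → Γ' ≈ᴱ Γ'' → Γ ≈ᴱ Γ''
  ≈ᴱ-trans e e' = lookup-≗ λ y → trans (lookup-≡ e y) (lookup-≡ e' y)

  ≈ᴱ-swap : ∀ x y τ σ (Γ : Env n) → ¬ x ≡ y → (x , τ) ∷ (y , σ) ∷ Γ ≈ᴱ (y , σ) ∷ (x , τ) ∷ Γ
  ≈ᴱ-swap x y τ σ Γ x≢y = lookup-≗ swapped
    where
    swapped : ∀ z → lookupEnv ((x , τ) ∷ (y , σ) ∷ Γ) z ≡ lookupEnv ((y , σ) ∷ (x , τ) ∷ Γ) z
    swapped z with z ≟ x | z ≟ y
    ... | yes refl | yes refl = contradiction refl x≢y
    ... | yes refl | no z≢y = begin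
      lookupEnv ((z , τ) ∷ (y , σ) ∷ Γ) z ≡⟨ lookupEnv-here ((y , σ) ∷ Γ) z τ ⟩
      just τ                              ≡⟨ lookupEnv-here Γ z τ ⟨
      lookupEnv ((z , τ) ∷ Γ) z           ≡⟨ lookupEnv-there ((z , τ) ∷ Γ) y σ z≢y ⟨
      lookupEnv ((y , σ) ∷ (z , τ) ∷ Γ) z ∎
    ... | no z≢x | yes refl = begin
      lookupEnv ((x , τ) ∷ (z , σ) ∷ Γ) z ≡⟨ lookupEnv-there ((z , σ) ∷ Γ) x τ z≢x ⟩
      lookupEnv ((z , σ) ∷ Γ) z           ≡⟨ lookupEnv-here Γ z σ ⟩
      just σ                              ≡⟨ lookupEnv-here ((x , τ) ∷ Γ) z σ ⟨
      lookupEnv ((z , σ) ∷ (x , τ) ∷ Γ) z ∎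
    ... | no z≢x | no z≢y = begin
      lookupEnv ((x , τ) ∷ (y , σ) ∷ Γ) z ≡⟨ lookupEnv-there ((y , σ) ∷ Γ) x τ z≢x ⟩
      lookupEnv ((y , σ) ∷ Γ) z           ≡⟨ lookupEnv-there Γ y σ z≢y ⟩
      lookupEnv Γ z                       ≡⟨ lookupEnv-there Γ x τ z≢x ⟨
      lookupEnv ((x , τ) ∷ Γ) z           ≡⟨ lookupEnv-there ((x , τ) ∷ Γ) y σ z≢y ⟨
      lookupEnv ((y , σ) ∷ (x , τ) ∷ Γ) z ∎

  ≈ᴱ-float : ∀ {k} τ (Γ : Env n) X → All ((k <_) ∘ proj₁) X → X ++ (k , τ) ∷ Γ ≈ᴱ (k , τ) ∷ X ++ Γ
  ≈ᴱ-float τ Γ [] [] = lookup-≗ λ y → refl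
  ≈ᴱ-float {k} τ Γ ((x , σ) ∷ X) (k<x ∷ k<X) =
    ≈ᴱ-trans (≈ᴱ-∷ x σ (≈ᴱ-float τ Γ X k<X)) (≈ᴱ-swap x k σ τ (X ++ Γ) (>⇒≢ k<x))

module _ {n : ℕ} (𝒯 : Forest n) where

  ⊢N-resp-≈ᴱ : ∀ {Γ Γ' N} → Γ ≈ᴱ Γ' → _⊢N_ 𝒯 Γ N → _⊢N_ 𝒯 Γ' N
  ⊢C-resp-≈ᴱ : ∀ {Γ Γ' A} → Γ ≈ᴱ Γ' → _⊢C_ 𝒯 Γ A → _⊢C_ 𝒯 Γ' A
  ⊢B-resp-≈ᴱ : ∀ {Γ Γ' b} → Γ ≈ᴱ Γ' → _⊢B_ 𝒯 Γ b → _⊢B_ 𝒯 Γ' b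
  ⊢N-resp-≈ᴱ {N = ν⟨ X ⟩∏ As} Γ≈ (Par typed below) =
    Par (λ i → ⊢C-resp-≈ᴱ (≈ᴱ-++ X Γ≈) (typed i))
        (λ i x τ x∈ tied y σ y∈ Γ'y → below i x τ x∈ tied y σ y∈ (trans (lookup-≡ Γ≈ y) Γ'y))
  ⊢C-resp-≈ᴱ Γ≈ (Choice typed) = Choice (λ b b∈ → ⊢B-resp-≈ᴱ Γ≈ (typed b b∈))
  ⊢C-resp-≈ᴱ Γ≈ (Repl typed) = Repl (⊢C-resp-≈ᴱ Γ≈ typed)
  ⊢B-resp-≈ᴱ Γ≈ (Tau typed) = Tau (⊢N-resp-≈ᴱ Γ≈ typed)
  ⊢B-resp-≈ᴱ {b = out a b · N} Γ≈ (Out Γa Γb typed) =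
    Out (trans (sym (lookup-≡ Γ≈ a)) Γa) (trans (sym (lookup-≡ Γ≈ b)) Γb) (⊢N-resp-≈ᴱ Γ≈ typed)
  ⊢B-resp-≈ᴱ {b = inp a x · N} Γ≈ (In {τx = τx} Γa typed (inj₁ τx≤ta)) =
    In (trans (sym (lookup-≡ Γ≈ a)) Γa) (⊢N-resp-≈ᴱ (≈ᴱ-∷ x τx Γ≈) typed) (inj₁ τx≤ta)
  ⊢B-resp-≈ᴱ {b = inp a x · N} Γ≈ (In {τx = τx} Γa typed (inj₂ migratable)) =
    In (trans (sym (lookup-≡ Γ≈ a)) Γa) (⊢N-resp-≈ᴱ (≈ᴱ-∷ x τx Γ≈) typed)
       (inj₂ λ i tied y σ y∈ Γ'y → migratable i tied y σ y∈ (trans (lookup-≡ Γ≈ y) Γ'y))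

  Chained : BT n → NF n → Set
  ChainedCs : BT n → List (Comp n) → Set
  ChainedBs : BT n → List (Branch n) → Set
  Chained root (ν⟨ X ⟩∏ As) =
    Linked (_<ᵀ_ 𝒯) (bases X) × All ((_<ᵀ_ 𝒯 root) ∘ baseOf ∘ proj₂) X × ChainedCs root As
  ChainedCs root [] = ⊤
  ChainedCs root (sumC bs ∷ As) = ChainedBs root bs × ChainedCs root As
  ChainedCs root (repC bs ∷ As) = ChainedBs root bs × ChainedCs root As
  ChainedBs root [] = ⊤
  ChainedBs root ((π · N) ∷ bs) = Chained root N × ChainedBs root bs

  ChainedCs-++ : ∀ {root} As Bs → ChainedCs root As → ChainedCs root Bs → ChainedCs root (As ++ Bs)
  ChainedCs-++ [] Bs _ chBs = chBs
  ChainedCs-++ (sumC bs ∷ As) Bs (chbs , chAs) chBs = chbs , ChainedCs-++ As Bs chAs chBs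
  ChainedCs-++ (repC bs ∷ As) Bs (chbs , chAs) chBs = chbs , ChainedCs-++ As Bs chAs chBs

  chained-bnN : ∀ {root} N → Chained root N → ∀ {y τ} → (y , τ) ∈ bnN N → _<ᵀ_ 𝒯 root (baseOf τ)
  chained-bnCs : ∀ {root} As → ChainedCs root As → ∀ {y τ} → (y , τ) ∈ bnCs As → _<ᵀ_ 𝒯 root (baseOf τ)
  chained-bnBs : ∀ {root} bs → ChainedBs root bs → ∀ {y τ} → (y , τ) ∈ bnBs bs → _<ᵀ_ 𝒯 root (baseOf τ)
  chained-bnN (ν⟨ X ⟩∏ As) (_ , aboveX , chAs) y∈ =
    [ All.lookup aboveX , chained-bnCs As chAs ]′ (∈-++⁻ X y∈)
  chained-bnCs (sumC bs ∷ As) (chbs , chAs) y∈ =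
    [ chained-bnBs bs chbs , chained-bnCs As chAs ]′ (∈-++⁻ (bnBs bs) y∈)
  chained-bnCs (repC bs ∷ As) (chbs , chAs) y∈ =
    [ chained-bnBs bs chbs , chained-bnCs As chAs ]′ (∈-++⁻ (bnBs bs) y∈)
  chained-bnBs ((π · N) ∷ bs) (chN , chbs) y∈ =
    [ chained-bnN N chN , chained-bnBs bs chbs ]′ (∈-++⁻ (bnN N) y∈)

  chained-safe : ∀ {root Γ} N → (∀ y {σ} → lookupEnv Γ y ≡ just σ → baseOf σ ≡ root)
               → Chained root N → Safe 𝒯 Γ N
  chained-safe N Γ-root chained y τ yτ∈ y' σ _ Γy' =
    subst (λ t → _<ᵀ_ 𝒯 t (baseOf τ)) (sym (Γ-root y' Γy')) (chained-bnN N chained yτ∈)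

  Leaf : Tree n → Set
  Leaf (leaf _) = ⊤
  Leaf (νnode _ _ _) = ⊥

  leaf-path : ∀ {F ts Q} → All Leaf F → PathF F ts Q → ts ≡ []
  leaf-path leaves (pick T∈ atLeaf) = refl
  leaf-path leaves (pick T∈ (down _)) = ⊥-elim (All.lookup leaves T∈)

  compatible-leaves : ∀ {P} → All Leaf (forestP P) → Compatible 𝒯 P
  compatible-leaves {P} leaves =
    P , reflP , λ ts Q path → subst (Linked _) (sym (leaf-path leaves path)) []

  leaves-seq : ∀ M → All Leaf (forestP (seq M))
  leaves-seq 𝟘 = []
  leaves-seq (M ⊕ M') = tt ∷ []
  leaves-seq (π ∙ P) = tt ∷ []

  leaves-compP : ∀ A → All Leaf (forestP (compP A))
  leaves-compP (sumC bs) = leaves-seq (sumB bs)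
  leaves-compP (repC bs) = tt ∷ []

  leaves-prodC : ∀ As → All Leaf (forestP (prodC As))
  leaves-prodC [] = []
  leaves-prodC (A ∷ []) = leaves-compP A
  leaves-prodC (A ∷ A' ∷ As) = ++⁺ (leaves-compP A) (leaves-prodC (A' ∷ As))

  νchain : List (Name × Ty n) → Proc n → Proc n
  νchain X P = foldr (λ xτ P' → ν (proj₁ xτ) (proj₂ xτ) P') P X

  νchain-path : ∀ X P {ts Q} → All Leaf (forestP P) → PathF (forestP (νchain X P)) ts Q → ts ≡ bases X
  νchain-path [] P leaves path = leaf-path leaves path
  νchain-path ((x , τ) ∷ X) P leaves (pick (here refl) (down path)) =
    cong (baseOf τ ∷_) (νchain-path X P leaves path)

  ShapedSeq : Seq n → Set
  ShapedSeq M = ∀ Q → SubM Q M → Compatible 𝒯 Q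

  shaped-νchain : ∀ X P → Linked (_<ᵀ_ 𝒯) (bases X) → All Leaf (forestP P) → Shaped 𝒯 P
                → Shaped 𝒯 (νchain X P)
  shaped-νchain [] P _ _ shaped = shaped
  shaped-νchain (xτ ∷ X) P linked leaves shaped Q sub-refl =
    _ , reflP , λ ts Q path → subst (Linked _) (sym (νchain-path (xτ ∷ X) P leaves path)) linked
  shaped-νchain (xτ ∷ X) P linked leaves shaped Q (sub-ν sub) =
    shaped-νchain X P (Linked.tail linked) leaves shaped Q sub

  shaped-seq : ∀ M → ShapedSeq M → Shaped 𝒯 (seq M)
  shaped-seq M shaped Q sub-refl = compatible-leaves (leaves-seq M)
  shaped-seq M shaped Q (sub-seq sub) = shaped Q sub

  shaped-bang : ∀ M → ShapedSeq M → Shaped 𝒯 (bang M)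
  shaped-bang M shaped Q sub-refl = compatible-leaves {bang M} (tt ∷ [])
  shaped-bang M shaped Q (sub-bang sub) = shaped Q sub

  shaped-nf : ∀ {root} N → Chained root N → Shaped 𝒯 (toProc N)
  shaped-prodC : ∀ {root} As → ChainedCs root As → Shaped 𝒯 (prodC As)
  shaped-sumB : ∀ {root} bs → ChainedBs root bs → ShapedSeq (sumB bs)
  shaped-branch : ∀ {root} π N → Chained root N → ShapedSeq (π ∙ toProc N)
  shaped-nf (ν⟨ X ⟩∏ As) (linked , _ , chAs) =
    shaped-νchain X (prodC As) linked (leaves-prodC As) (shaped-prodC As chAs)
  shaped-prodC [] _ = shaped-seq 𝟘 λ { Q subM-self → compatible-leaves (leaves-seq 𝟘) }
  shaped-prodC (sumC bs ∷ []) (chbs , _) = shaped-seq (sumB bs) (shaped-sumB bs chbs)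
  shaped-prodC (repC bs ∷ []) (chbs , _) = shaped-bang (sumB bs) (shaped-sumB bs chbs)
  shaped-prodC (A ∷ A' ∷ As) _ Q sub-refl = compatible-leaves (leaves-prodC (A ∷ A' ∷ As))
  shaped-prodC (sumC bs ∷ A' ∷ As) (chbs , _) Q (sub-∥ˡ sub) =
    shaped-seq (sumB bs) (shaped-sumB bs chbs) Q sub
  shaped-prodC (repC bs ∷ A' ∷ As) (chbs , _) Q (sub-∥ˡ sub) =
    shaped-bang (sumB bs) (shaped-sumB bs chbs) Q sub
  shaped-prodC (sumC bs ∷ A' ∷ As) (_ , chAs) Q (sub-∥ʳ sub) = shaped-prodC (A' ∷ As) chAs Q sub
  shaped-prodC (repC bs ∷ A' ∷ As) (_ , chAs) Q (sub-∥ʳ sub) = shaped-prodC (A' ∷ As) chAs Q sub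
  shaped-sumB [] _ Q subM-self = compatible-leaves (leaves-seq 𝟘)
  shaped-sumB ((π · N) ∷ []) (chN , _) = shaped-branch π N chN
  shaped-sumB (b ∷ b' ∷ bs) _ Q subM-self = compatible-leaves (leaves-seq (sumB (b ∷ b' ∷ bs)))
  shaped-sumB ((π · N) ∷ b' ∷ bs) (chN , _) Q (subM-⊕ˡ sub) = shaped-branch π N chN Q sub
  shaped-sumB ((π · N) ∷ b' ∷ bs) (_ , chbs) Q (subM-⊕ʳ sub) = shaped-sumB (b' ∷ bs) chbs Q sub
  shaped-branch π N chN Q subM-self = compatible-leaves (leaves-seq (π ∙ toProc N))
  shaped-branch π N chN Q (subM-∙ sub) = shaped-nf N chN Q sub

module Stratification {n : ℕ} (𝒯 : Forest n) (ty : Name → Ty n) (root : BT n) where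

  open ≡-Reasoning

  infix 4 _⊏_
  _⊏_ : BT n → BT n → Set
  _⊏_ = _<ᵀ_ 𝒯

  Above : BT n → Proc n → Set
  Above t (ν y σ P) = t ⊏ baseOf σ
  Above t (P ∥ Q) = ⊤
  Above t (seq M) = ⊤
  Above t (bang M) = ⊤

  data Flat : Proc n → Set where
    flat-seq  : ∀ {M} → Flat (seq M)
    flat-bang : ∀ {M} → Flat (bang M)
    flat-∥    : ∀ {P Q} → Flat P → Flat Q → Flat (P ∥ Q)

  flat-binders : ∀ {P} → Flat P → ∀ ρ k → binders (proj₁ (nfP ρ k P)) ≡ []
  flat-binders (flat-seq {M}) ρ k with nfM ρ k M
  ... | [] , _ = refl
  ... | _ ∷ _ , _ = refl
  flat-binders (flat-bang {M}) ρ k with nfM ρ k M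
  ... | [] , _ = refl
  ... | _ ∷ _ , _ = refl
  flat-binders (flat-∥ {P} {Q} fP fQ) ρ k with nfP ρ k P | flat-binders fP ρ k
  ... | ν⟨ _ ⟩∏ _ , k' | refl with nfP ρ k' Q | flat-binders fQ ρ k'
  ... | ν⟨ _ ⟩∏ _ , _ | refl = refl

  -- Parallel components carry no restriction, so that the restrictions of a normal form stay a chain.
  data Stratified : Proc n → Set
  data StratifiedSeq : Seq n → Set
  data Stratified where
    ν-strat : ∀ {x τ P} → τ ≡ ty x → root ⊏ baseOf τ
            → (∀ {z} → z ∈ fnP (ν x τ P) → baseOf (ty z) ⊏ baseOf τ)
            → Above (baseOf τ) P → Stratified P → Stratified (ν x τ P)
    ∥-strat : ∀ {P Q} → Flat P → Flat Q → Stratified P → Stratified Q → Stratified (P ∥ Q)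
    seq-strat : ∀ {M} → StratifiedSeq M → Stratified (seq M)
    bang-strat : ∀ {M} → StratifiedSeq M → Stratified (bang M)
  data StratifiedSeq where
    𝟘-strat : StratifiedSeq 𝟘
    inp-strat : ∀ {a x P ta} → ty a ≡ ta ⟦ ty x ⟧ → _≤ᵀ_ 𝒯 (baseOf (ty x)) ta → Stratified P
              → StratifiedSeq (inp a x ∙ P)
    out-strat : ∀ {a b P ta} → ty a ≡ ta ⟦ ty b ⟧ → Stratified P → StratifiedSeq (out a b ∙ P)

  -- The invariant of a call nfP ρ k P: Γ types the ρ-renamed free names of P as ty does, and k is fresh.
  record Tracks (ρ : Name → Name) (Γ : Env n) (k : ℕ) (zs : List Name) : Set where
    field
      typed-renaming : ∀ {z} → z ∈ zs → lookupEnv Γ (ρ z) ≡ just (ty z)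
      dom<fresh      : ∀ {y σ} → lookupEnv Γ y ≡ just σ → y < k
  open Tracks

  tracks-⊆ : ∀ {ρ Γ k zs zs'} → (∀ {z} → z ∈ zs → z ∈ zs') → Tracks ρ Γ k zs' → Tracks ρ Γ k zs
  tracks-⊆ zs⊆zs' tracks = record
    { typed-renaming = typed-renaming tracks ∘ zs⊆zs' ; dom<fresh = dom<fresh tracks }

  tracks-≤ : ∀ {ρ Γ k k' zs} → k ≤ k' → Tracks ρ Γ k zs → Tracks ρ Γ k' zs
  tracks-≤ k≤k' tracks = record
    { typed-renaming = typed-renaming tracks ; dom<fresh = λ Γy → <-≤-trans (dom<fresh tracks Γy) k≤k' }

  tracks-bind : ∀ {ρ Γ k zs} x τ zs' → τ ≡ ty x → (∀ {z} → z ∈ zs' → ¬ z ≡ x → z ∈ zs)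
              → Tracks ρ Γ k zs → Tracks (upd ρ x k) ((k , τ) ∷ Γ) (suc k) zs'
  tracks-bind {ρ} {Γ} {k} x τ zs' refl zs'⊆zs tracks =
    record { typed-renaming = typed ; dom<fresh = bounded }
    where
    typed : ∀ {z} → z ∈ zs' → lookupEnv ((k , τ) ∷ Γ) (upd ρ x k z) ≡ just (ty z)
    typed {z} z∈ with z ≟ x
    ... | yes refl = trans (cong (lookupEnv ((k , τ) ∷ Γ)) (upd-same ρ z k)) (lookupEnv-here Γ k τ)
    ... | no z≢x = begin
      lookupEnv ((k , τ) ∷ Γ) (upd ρ x k z) ≡⟨ cong (lookupEnv ((k , τ) ∷ Γ)) (upd-other ρ x k z≢x) ⟩
      lookupEnv ((k , τ) ∷ Γ) (ρ z)         ≡⟨ lookupEnv-there Γ k τ (<⇒≢ (dom<fresh tracks Γρz)) ⟩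
      lookupEnv Γ (ρ z)                     ≡⟨ Γρz ⟩
      just (ty z)                           ∎
      where
      Γρz : lookupEnv Γ (ρ z) ≡ just (ty z)
      Γρz = typed-renaming tracks (zs'⊆zs z∈ z≢x)
    bounded : ∀ {y σ} → lookupEnv ((k , τ) ∷ Γ) y ≡ just σ → y < suc k
    bounded {y} Γy with y ≟ k
    ... | yes refl = ≤-refl
    ... | no y≢k = m<n⇒m<1+n (dom<fresh tracks (trans (sym (lookupEnv-there Γ k τ y≢k)) Γy))

  -- The premises of (Par), required of every component and every restricted name, tied or not.
  StronglyTyped : Env n → NF n → Set
  StronglyTyped Γ (ν⟨ X ⟩∏ As) =
    All (_⊢C_ 𝒯 (X ++ Γ)) As × (∀ {A x τ} → A ∈ As → (x , τ) ∈ X → BasesBelow 𝒯 Γ (fnC A) (baseOf τ))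

  stronglyTyped⇒⊢N : ∀ {Γ} N → StronglyTyped Γ N → _⊢N_ 𝒯 Γ N
  stronglyTyped⇒⊢N (ν⟨ X ⟩∏ As) (typed , bounded) =
    Par (λ i → All.lookup typed (∈-lookup i)) (λ i x τ x∈ _ → bounded (∈-lookup i) x∈)

  stronglyTyped-ν : ∀ {ρ Γ k x τ P} {X : List (Name × Ty n)} {As}
    → (∀ {z} → z ∈ fnP (ν x τ P) → baseOf (ty z) ⊏ baseOf τ)
    → Tracks ρ Γ k (fnP (ν x τ P))
    → All ((k <_) ∘ proj₁) X
    → (∀ {y} → y ∈ fnCs As → y ∈ boundNames X ⊎ Image (upd ρ x k) (fnP P) y)
    → StronglyTyped ((k , τ) ∷ Γ) (ν⟨ X ⟩∏ As)
    → StronglyTyped Γ (ν⟨ (k , τ) ∷ X ⟩∏ As)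
  stronglyTyped-ν {ρ} {Γ} {k} {x} {τ} {P} {X} {As} below tracks fresh free (typed , bounded) =
    All.map (⊢C-resp-≈ᴱ 𝒯 (≈ᴱ-float τ Γ X fresh)) typed , bounded'
    where
    below-τ : ∀ {y σ} → y ∈ fnCs As → lookupEnv Γ y ≡ just σ → baseOf σ ⊏ baseOf τ
    below-τ {y} {σ} y∈ Γy with free y∈
    ... | inj₁ y∈X = contradiction (All.lookup (map⁺ fresh) y∈X) (<⇒≱ (m<n⇒m<1+n (dom<fresh tracks Γy)))
    ... | inj₂ (z , z∈ , y≡) with z ≟ x
    ...   | yes refl = contradiction (trans y≡ (upd-same ρ z k)) (<⇒≢ (dom<fresh tracks Γy))
    ...   | no z≢x = subst (λ σ → baseOf σ ⊏ baseOf τ) ty-z≡σ (below z∈')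
      where
      z∈' : z ∈ remove x (fnP P)
      z∈' = ∈-remove⁺ (fnP P) z∈ z≢x
      ty-z≡σ : ty z ≡ σ
      ty-z≡σ = just-injective (begin
        just (ty z)       ≡⟨ typed-renaming tracks z∈' ⟨
        lookupEnv Γ (ρ z) ≡⟨ cong (lookupEnv Γ) (trans y≡ (upd-other ρ x k z≢x)) ⟨
        lookupEnv Γ y     ≡⟨ Γy ⟩
        just σ            ∎)
    bounded' : ∀ {A x' τ'} → A ∈ As → (x' , τ') ∈ (k , τ) ∷ X → BasesBelow 𝒯 Γ (fnC A) (baseOf τ')
    bounded' A∈ (here refl) y σ y∈ Γy = below-τ (∈-fnCs⁺ As A∈ y∈) Γy
    bounded' A∈ (there x∈) y σ y∈ Γy =
      bounded A∈ x∈ y σ y∈ (trans (lookupEnv-there Γ k τ (<⇒≢ (dom<fresh tracks Γy))) Γy)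

  StartsAbove : BT n → NF n → Set
  StartsAbove t N = Linked _⊏_ (t ∷ bases (binders N))

  flat-startsAbove : ∀ {P t} → Flat P → ∀ ρ k → StartsAbove t (proj₁ (nfP ρ k P))
  flat-startsAbove flat ρ k rewrite flat-binders flat ρ k = [-]

  startsAbove : ∀ {P t} → Stratified P → Above t P → ∀ ρ k
              → Chained 𝒯 root (proj₁ (nfP ρ k P)) → StartsAbove t (proj₁ (nfP ρ k P))
  startsAbove (ν-strat {x} {τ} {P} _ _ _ _ _) t⊏τ ρ k with nfP (upd ρ x k) (suc k) P
  ... | ν⟨ _ ⟩∏ _ , _ = λ (linked , _) → t⊏τ ∷ linked
  startsAbove (∥-strat fP fQ _ _) _ ρ k _ = flat-startsAbove (flat-∥ fP fQ) ρ k
  startsAbove (seq-strat {M} _) _ ρ k _ = flat-startsAbove (flat-seq {M}) ρ k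
  startsAbove (bang-strat {M} _) _ ρ k _ = flat-startsAbove (flat-bang {M}) ρ k

  nfP-typed : ∀ {P} → Stratified P → ∀ ρ k Γ → Tracks ρ Γ k (fnP P)
            → StronglyTyped Γ (proj₁ (nfP ρ k P)) × Chained 𝒯 root (proj₁ (nfP ρ k P))
  nfM-typed : ∀ {M} → StratifiedSeq M → ∀ ρ k Γ → Tracks ρ Γ k (fnM M)
            → All (_⊢B_ 𝒯 Γ) (proj₁ (nfM ρ k M)) × ChainedBs 𝒯 root (proj₁ (nfM ρ k M))
  nfP-typed (ν-strat {x} {τ} {P} τ≡ root⊏τ below above S) ρ k Γ tracks
    with nfP (upd ρ x k) (suc k) P
       | nfP-typed S (upd ρ x k) (suc k) ((k , τ) ∷ Γ)
           (tracks-bind x τ (fnP P) τ≡ (∈-remove⁺ (fnP P)) tracks)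
       | startsAbove S above (upd ρ x k) (suc k)
       | nfP-fresh (upd ρ x k) (suc k) P
       | nfP-free (upd ρ x k) (suc k) P
  ... | ν⟨ X ⟩∏ As , _ | typed , chained@(_ , aboveX , chAs) | starts | _ , fresh | free =
    stronglyTyped-ν {P = P} below tracks fresh free typed , (starts chained , root⊏τ ∷ aboveX , chAs)
  nfP-typed (∥-strat {P} {Q} fP fQ SP SQ) ρ k Γ tracks
    with nfP ρ k P | nfP-typed SP ρ k Γ (tracks-⊆ ∈-++⁺ˡ tracks) | flat-binders fP ρ k | nfP-fresh ρ k P
  ... | ν⟨ _ ⟩∏ As , k' | (typedP , _) , (_ , _ , chAs) | refl | k≤k' , _
    with nfP ρ k' Q
       | nfP-typed SQ ρ k' Γ (tracks-≤ k≤k' (tracks-⊆ (∈-++⁺ʳ (fnP P)) tracks))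
       | flat-binders fQ ρ k'
  ... | ν⟨ _ ⟩∏ Bs , _ | (typedQ , _) , (_ , _ , chBs) | refl =
    (++⁺ typedP typedQ , λ _ ()) , ([] , [] , ChainedCs-++ 𝒯 As Bs chAs chBs)
  nfP-typed (seq-strat {M} S) ρ k Γ tracks with nfM ρ k M | nfM-typed S ρ k Γ tracks
  ... | [] , _ | _ = ([] , λ ()) , ([] , [] , tt)
  ... | _ ∷ _ , _ | typed , chained =
    (Choice (λ _ → All.lookup typed) ∷ [] , λ _ ()) , ([] , [] , chained , tt)
  nfP-typed (bang-strat {M} S) ρ k Γ tracks with nfM ρ k M | nfM-typed S ρ k Γ tracks
  ... | [] , _ | _ = ([] , λ ()) , ([] , [] , tt)
  ... | _ ∷ _ , _ | typed , chained =
    (Repl (Choice (λ _ → All.lookup typed)) ∷ [] , λ _ ()) , ([] , [] , chained , tt)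
  nfM-typed 𝟘-strat ρ k Γ tracks = [] , tt
  nfM-typed (inp-strat {a} {x} {P} ty-a x≤a S) ρ k Γ tracks
    with nfP (upd ρ x k) (suc k) P
       | nfP-typed S (upd ρ x k) (suc k) ((k , ty x) ∷ Γ)
           (tracks-bind x (ty x) (fnP P) refl (λ z∈ z≢x → there (∈-remove⁺ (fnP P) z∈ z≢x)) tracks)
  ... | ν⟨ _ ⟩∏ _ , _ | typed , chained =
    In (trans (typed-renaming tracks (here refl)) (cong just ty-a)) (stronglyTyped⇒⊢N _ typed) (inj₁ x≤a)
    ∷ [] , chained , tt
  nfM-typed (out-strat {a} {b} {P} ty-a S) ρ k Γ tracks
    with nfP ρ k P | nfP-typed S ρ k Γ (tracks-⊆ (there ∘ there) tracks)
  ... | ν⟨ _ ⟩∏ _ , _ | typed , chained =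
    Out (trans (typed-renaming tracks (here refl)) (cong just ty-a)) (typed-renaming tracks (there (here refl)))
        (stronglyTyped⇒⊢N _ typed)
    ∷ [] , chained , tt

-- t-c i q has rank c i q ∸ 1, and the forest is the chain of the types of rank 0, 1, …, size.
module LevelChain (n ℓ : ℕ) .{{_ : NonZero n}} where

  size : ℕ
  size = suc ℓ * n

  rank : BT n → ℕ
  rank t-r = 0
  rank (t-c i q) = suc (i * n + toℕ q)
  rank (t-other _) = 0

  decode : ℕ → BT n
  decode zero = t-r
  decode (suc m) = t-c (m / n) (fromℕ< (m%n<n m n))

  rank-decode : ∀ m → rank (decode m) ≡ m
  rank-decode zero = refl
  rank-decode (suc m) = cong suc (begin
    m / n * n + toℕ (fromℕ< (m%n<n m n)) ≡⟨ cong (m / n * n +_) (toℕ-fromℕ< (m%n<n m n)) ⟩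
    m / n * n + m % n                    ≡⟨ +-comm (m / n * n) (m % n) ⟩
    m % n + m / n * n                    ≡⟨ m≡m%n+[m/n]*n m n ⟨
    m                                    ∎)
    where open ≡-Reasoning

  decode-rank : ∀ i q → decode (rank (t-c i q)) ≡ t-c i q
  decode-rank i q = cong₂ t-c quotient (toℕ-injective (trans (toℕ-fromℕ< _) remainder))
    where
    open ≡-Reasoning
    q%n≡q : toℕ q % n ≡ toℕ q
    q%n≡q = m<n⇒m%n≡m (toℕ<n q)
    remainder : (i * n + toℕ q) % n ≡ toℕ q
    remainder = begin
      (i * n + toℕ q) % n ≡⟨ cong (_% n) (+-comm (i * n) (toℕ q)) ⟩
      (toℕ q + i * n) % n ≡⟨ [m+kn]%n≡m%n (toℕ q) i n ⟩
      toℕ q % n           ≡⟨ q%n≡q ⟩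
      toℕ q               ∎
    no-carry : (i * n) % n + toℕ q % n < n
    no-carry = subst (_< n) (sym (cong₂ _+_ (m*n%n≡0 i n) q%n≡q)) (toℕ<n q)
    quotient : (i * n + toℕ q) / n ≡ i
    quotient = begin
      (i * n + toℕ q) / n   ≡⟨ +-distrib-/ (i * n) (toℕ q) no-carry ⟩
      i * n / n + toℕ q / n ≡⟨ cong₂ _+_ (m*n/n≡m i n) (m<n⇒m/n≡0 (toℕ<n q)) ⟩
      i + 0                 ≡⟨ +-identityʳ i ⟩
      i                     ∎

  parentOfRank : ℕ → Maybe (BT n)
  parentOfRank zero = nothing
  parentOfRank (suc m) with suc m ≤? size
  ... | yes _ = just (decode m)
  ... | no _ = nothing

  parentOfRank-suc : ∀ {m} → suc m ≤ size → parentOfRank (suc m) ≡ just (decode m)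
  parentOfRank-suc {m} m<size with suc m ≤? size
  ... | yes _ = refl
  ... | no m≮size = contradiction m<size m≮size

  parentOfRank-just : ∀ {r s} → parentOfRank r ≡ just s → ∃ λ m → r ≡ suc m × suc m ≤ size × decode m ≡ s
  parentOfRank-just {suc m} eq with suc m ≤? size
  parentOfRank-just {suc m} refl | yes m<size = m , refl , m<size , refl

  parent : BT n → Maybe (BT n)
  parent t = parentOfRank (rank t)

  _⊏_ : BT n → BT n → Set
  _⊏_ = TransClosure (ParentRel parent)

  parent-rank : ∀ {s t} → ParentRel parent s t → rank s < rank t
  parent-rank {s} {t} edge with parentOfRank-just edge
  ... | m , rank-t , _ , refl = subst₂ _<_ (sym (rank-decode m)) (sym rank-t) ≤-refl

  ⊏-rank : ∀ {s t} → s ⊏ t → rank s < rank t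
  ⊏-rank [ edge ] = parent-rank edge
  ⊏-rank (edge ∷ path) = <-trans (parent-rank edge) (⊏-rank path)

  decode-parent : ∀ {m} → suc m ≤ size → ParentRel parent (decode m) (decode (suc m))
  decode-parent {m} 1+m≤size = trans (cong parentOfRank (rank-decode (suc m))) (parentOfRank-suc 1+m≤size)

  decode-⊏ : ∀ {m m'} → m < m' → m' ≤ size → decode m ⊏ decode m'
  decode-⊏ {m} {suc m'} m<1+m' 1+m'≤size with m<1+n⇒m<n∨m≡n m<1+m'
  ... | inj₁ m<m' = decode-⊏ m<m' (<⇒≤ 1+m'≤size) ∷ʳ decode-parent 1+m'≤size
  ... | inj₂ refl = [ decode-parent 1+m'≤size ]

  nodes : List (BT n)
  nodes = map decode (upTo (suc size))

  decode-∈ : ∀ {m} → m ≤ size → decode m ∈ nodes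
  decode-∈ m≤size = ∈-map⁺ decode (∈-upTo⁺ (s≤s m≤size))

  t-c-∈ : ∀ i q → rank (t-c i q) ≤ size → t-c i q ∈ nodes
  t-c-∈ i q rank≤size = subst (_∈ nodes) (decode-rank i q) (decode-∈ rank≤size)

  rank≤size : ∀ i q → i ≤ ℓ → rank (t-c i q) ≤ size
  rank≤size i q i≤ℓ = begin
    suc (i * n + toℕ q) ≡⟨ +-suc (i * n) (toℕ q) ⟨
    i * n + suc (toℕ q) ≤⟨ +-monoʳ-≤ (i * n) (toℕ<n q) ⟩
    i * n + n           ≡⟨ +-comm (i * n) n ⟩
    suc i * n           ≤⟨ *-monoˡ-≤ n (s≤s i≤ℓ) ⟩
    suc ℓ * n           ∎
    where open ≤-Reasoning

  parent-closed : ∀ s t → ParentRel parent s t → s ∈ nodes × t ∈ nodes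
  parent-closed s t-r ()
  parent-closed s (t-other _) ()
  parent-closed s (t-c i q) edge with parentOfRank-just {rank (t-c i q)} edge
  ... | m , refl , m<size , refl = decode-∈ (<⇒≤ m<size) , t-c-∈ i q m<size

  forest : Forest n
  forest = record
    { parent = parent
    ; nodes = nodes
    ; closed = parent-closed
    ; acyclic = λ t cycle → <-irrefl refl (⊏-rank cycle)
    }

  ty : Name → Ty n
  ty zero = base t-r
  ty (suc zero) = base t-r
  ty (suc (suc m)) = decode (suc m) ⟦ base t-r ⟧

  ty-c : ∀ i q → ty (2 + (i * n + toℕ q)) ≡ t-c i q ⟦ base t-r ⟧
  ty-c i q = cong (_⟦ base t-r ⟧) (decode-rank i q)

  baseOf-ty : ∀ z → baseOf (ty z) ≡ decode (pred z)
  baseOf-ty zero = refl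
  baseOf-ty (suc zero) = refl
  baseOf-ty (suc (suc m)) = refl

  pred-< : ∀ {z x} → z < x → 2 ≤ x → pred z < pred x
  pred-< {zero} _ 2≤x = pred-mono-≤ 2≤x
  pred-< {suc _} z<x _ = pred-mono-< z<x

  ty-⊏ : ∀ {z x} → z < x → 2 ≤ x → x ≤ suc size → baseOf (ty z) ⊏ baseOf (ty x)
  ty-⊏ {z} {x} z<x 2≤x x≤ =
    subst₂ _⊏_ (sym (baseOf-ty z)) (sym (baseOf-ty x)) (decode-⊏ (pred-< z<x 2≤x) (pred-mono-≤ x≤))

module StratifiedEncoding (n' ℓ : ℕ) (δ : List (Trans (suc n') ℓ)) (q₀ : Fin (suc n'))
               (f₀ : DataValue ℓ → Maybe (Fin (suc n'))) where

  n : ℕ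
  n = suc n'

  𝒜 : NDCMA ℓ
  𝒜 = record { n = n ; δ = δ ; q₀ = q₀ ; f₀ = f₀ }

  open Encoding 𝒜
  open LevelChain n ℓ
  open Stratification forest ty t-r hiding (_⊏_)

  c-< : ∀ {k L} q → k < L → c k q < c L zero
  c-< {k} {L} q k<L = s≤s (s≤s (begin-strict
    k * n + toℕ q ≡⟨ +-comm (k * n) (toℕ q) ⟩
    toℕ q + k * n <⟨ +-monoˡ-< (k * n) (toℕ<n q) ⟩
    n + k * n     ≤⟨ *-monoˡ-≤ n k<L ⟩
    L * n         ≡⟨ +-identityʳ (L * n) ⟨
    L * n + 0     ∎))
    where open ≤-Reasoning

  c-≤ : ∀ {a b} → a ≤ b → c a zero ≤ c b zero
  c-≤ a≤b = s≤s (s≤s (+-monoˡ-≤ 0 (*-monoˡ-≤ n a≤b)))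

  c-suc : ∀ m → c m zero + n ≡ c (suc m) zero
  c-suc m = cong (suc ∘ suc) (begin
    m * n + 0 + n ≡⟨ cong (_+ n) (+-identityʳ (m * n)) ⟩
    m * n + n     ≡⟨ +-comm (m * n) n ⟩
    n + m * n     ≡⟨ +-identityʳ (n + m * n) ⟨
    n + m * n + 0 ∎)
    where open ≡-Reasoning

  c-offset : ∀ m q → c m q ≡ c m zero + toℕ q
  c-offset m q = cong (λ v → suc (suc (v + toℕ q))) (sym (+-identityʳ (m * n)))

  ⊏-by-name : ∀ {z x} → z < x → 2 ≤ x → x < c (suc ℓ) zero → baseOf (ty z) ⊏ baseOf (ty x)
  ⊏-by-name {x = x} z<x 2≤x x<top =
    ty-⊏ z<x 2≤x (subst (x ≤_) (cong suc (+-identityʳ size)) (s≤s⁻¹ x<top))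

  data Consecutive : ℕ → ℕ → List ℕ → Set where
    done : ∀ {a} → Consecutive a a []
    next : ∀ {a b x xs} → x ≡ a → Consecutive (suc a) b xs → Consecutive a b (x ∷ xs)

  consecutive-≤ : ∀ {a b xs} → Consecutive a b xs → a ≤ b
  consecutive-≤ done = ≤-refl
  consecutive-≤ (next _ rest) = <⇒≤ (consecutive-≤ rest)

  consecutive-< : ∀ {a b xs} → Consecutive a b xs → All (_< b) xs
  consecutive-< done = []
  consecutive-< (next refl rest) = consecutive-≤ rest ∷ consecutive-< rest

  consecutive-++ : ∀ {a b d xs ys} → Consecutive a b xs → Consecutive b d ys → Consecutive a d (xs ++ ys)
  consecutive-++ done ys = ys
  consecutive-++ (next x≡a xs) ys = next x≡a (consecutive-++ xs ys)

  consecutive-applyUpTo : ∀ cnt {a} (f : ℕ → ℕ) → (∀ t → f t ≡ a + t)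
                        → Consecutive a (a + cnt) (applyUpTo f cnt)
  consecutive-applyUpTo zero {a} f f≡ = subst (λ b → Consecutive a b []) (sym (+-identityʳ a)) done
  consecutive-applyUpTo (suc cnt) {a} f f≡ =
    next (trans (f≡ 0) (+-identityʳ a))
      (subst (λ b → Consecutive (suc a) b (applyUpTo (f ∘ suc) cnt)) (sym (+-suc a cnt))
        (consecutive-applyUpTo cnt (f ∘ suc) (λ t → trans (f≡ (suc t)) (+-suc a t))))

  consecutive-tabulate : ∀ k {a} (f : Fin k → ℕ) → (∀ i → f i ≡ a + toℕ i)
                       → Consecutive a (a + k) (tabulate f)
  consecutive-tabulate zero {a} f f≡ = subst (λ b → Consecutive a b []) (sym (+-identityʳ a)) done
  consecutive-tabulate (suc k) {a} f f≡ =
    next (trans (f≡ zero) (+-identityʳ a))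
      (subst (λ b → Consecutive (suc a) b (tabulate (f ∘ Fin.suc))) (sym (+-suc a k))
        (consecutive-tabulate k (f ∘ Fin.suc) (λ i → trans (f≡ (Fin.suc i)) (+-suc a (toℕ i)))))

  levelNames : ℕ → List Name
  levelNames m = map (c m) (allFin n)

  consecutive-levelNames : ∀ m → Consecutive (c m zero) (c (suc m) zero) (levelNames m)
  consecutive-levelNames m =
    subst₂ (Consecutive (c m zero)) (c-suc m) (sym (map-tabulate id (c m)))
      (consecutive-tabulate n (c m) (c-offset m))

  consecutive-levels : ∀ {j i} → j ≤ i → Consecutive (suc j) (suc i) (levels j i)
  consecutive-levels {j} {i} j≤i =
    subst₂ (Consecutive (suc j)) (cong suc (m+[n∸m]≡n j≤i)) (sym (map-upTo (λ m → suc (j + m)) (i ∸ j)))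
      (consecutive-applyUpTo (i ∸ j) (λ m → suc (j + m)) (λ _ → refl))

  νnames : List Name → Proc n → Proc n
  νnames xs P = foldr (λ x P' → ν x (ty x) P') P xs

  νC≡νnames : ∀ m P → νC m P ≡ νnames (levelNames m) P
  νC≡νnames m P = go (allFin n)
    where
    go : ∀ qs → foldr (λ q P' → ν (c m q) (tyC m q) P') P qs ≡ νnames (map (c m) qs) P
    go [] = refl
    go (q ∷ qs) = cong₂ (ν (c m q)) (sym (ty-c m q)) (go qs)

  νC-levels : ∀ {a b ls} P → Consecutive a b ls
            → ∃ λ xs → foldr νC P ls ≡ νnames xs P × Consecutive (c a zero) (c b zero) xs
  νC-levels P done = [] , refl , done
  νC-levels {a} P (next {xs = ls} refl rest) with νC-levels P rest
  ... | xs , P≡ , consecutive = levelNames a ++ xs , νC-a , consecutive-++ (consecutive-levelNames a) consecutive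
    where
    open ≡-Reasoning
    νC-a : νC a (foldr νC P ls) ≡ νnames (levelNames a ++ xs) P
    νC-a = begin
      νC a (foldr νC P ls)                ≡⟨ cong (νC a) P≡ ⟩
      νC a (νnames xs P)                  ≡⟨ νC≡νnames a (νnames xs P) ⟩
      νnames (levelNames a) (νnames xs P) ≡⟨ foldr-++ (λ x P' → ν x (ty x) P') P (levelNames a) xs ⟨
      νnames (levelNames a ++ xs) P       ∎

  FnBelow : ℕ → Proc n → Set
  FnBelow B P = ∀ {z} → z ∈ fnP P → z < B

  StratifiedBelow : ℕ → Proc n → Set
  StratifiedBelow B P = Stratified P × FnBelow B P

  -- Consecutiveness is what makes every free name of the result lie below the first bound name.
  stratified-νnames : ∀ {a b xs P Q} → Consecutive a b xs → 2 ≤ a → b ≤ c (suc ℓ) zero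
                    → StratifiedBelow b (P ∥ Q) → StratifiedBelow a (νnames xs (P ∥ Q))
  stratified-νnames done _ _ body = body
  stratified-νnames {a} {b} {_ ∷ xs} {P} {Q} (next refl rest) 2≤a b≤top body
    with stratified-νnames rest (≤-trans 2≤a (n≤1+n a)) b≤top body
  ... | S , below = ν-strat refl (⊏-by-name (≤-trans (s≤s z≤n) 2≤a) 2≤a a<top)
                      (λ z∈ → ⊏-by-name (fn<a z∈) 2≤a a<top) (above rest) S , fn<a
    where
    a<top : a < c (suc ℓ) zero
    a<top = <-≤-trans (consecutive-≤ rest) b≤top
    fn<a : FnBelow a (ν a (ty a) (νnames xs (P ∥ Q)))
    fn<a z∈ with ∈-remove⁻ _ z∈
    ... | z∈' , z≢a = ≤∧≢⇒< (s≤s⁻¹ (below z∈')) z≢a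
    above : ∀ {ys} → Consecutive (suc a) b ys → Above (baseOf (ty a)) (νnames ys (P ∥ Q))
    above done = tt
    above (next refl rest') =
      ⊏-by-name ≤-refl (≤-trans 2≤a (n≤1+n a)) (<-≤-trans (consecutive-≤ rest') b≤top)

  νC-stratified : ∀ {a b ls P Q} → Consecutive a b ls → b ≤ suc ℓ
                → StratifiedBelow (c b zero) (P ∥ Q) → StratifiedBelow (c a zero) (foldr νC (P ∥ Q) ls)
  νC-stratified {a} {P = P} {Q} levels b≤ body with νC-levels (P ∥ Q) levels
  ... | xs , P≡ , names rewrite P≡ = stratified-νnames names (s≤s (s≤s z≤n)) (c-≤ b≤) body

  Component : ℕ → Proc n → Set
  Component B P = Flat P × StratifiedBelow B P

  component-≤ : ∀ {B B' P} → B ≤ B' → Component B P → Component B' P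
  component-≤ B≤B' (flat , S , below) = flat , S , λ z∈ → <-≤-trans (below z∈) B≤B'

  ∥-component : ∀ {B P Q} → Component B P → Component B Q → Component B (P ∥ Q)
  ∥-component {P = P} (flatP , SP , belowP) (flatQ , SQ , belowQ) =
    flat-∥ flatP flatQ , ∥-strat flatP flatQ SP SQ , λ z∈ → [ belowP , belowQ ]′ (∈-++⁻ (fnP P) z∈)

  prod-component : ∀ {B} Ps → All (Component B) Ps → Component B (prod Ps)
  prod-component [] [] = flat-seq , seq-strat 𝟘-strat , λ ()
  prod-component (P ∷ []) (comp ∷ []) = comp
  prod-component (P ∷ Q ∷ Ps) (comp ∷ comps) = ∥-component comp (prod-component (Q ∷ Ps) comps)

  bang-component : ∀ {B M} → StratifiedBelow B (seq M) → Component B (bang M)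
  bang-component (seq-strat S , below) = flat-bang , bang-strat S , below

  outbar-component : ∀ {B} m q → c m q < B → Component B (outbar (c m q))
  outbar-component m q c<B = flat-seq , seq-strat (out-strat (ty-c m q) (seq-strat 𝟘-strat)) , below
    where
    below : FnBelow _ (outbar (c m q))
    below (here refl) = c<B
    below (there (here refl)) = ≤-<-trans z≤n c<B

  outs-components : ∀ k qs L → k + length qs ≤ L → All (Component (c L zero)) (outs k qs)
  outs-components k [] L _ = []
  outs-components k (q ∷ qs) L k+|qs|≤L =
    outbar-component k q (c-< q (≤-<-trans (m≤m+n k (length qs)) k+|qs|<L))
    ∷ outs-components (suc k) qs L k+|qs|<L
    where
    k+|qs|<L : suc k + length qs ≤ L
    k+|qs|<L = subst (_≤ L) (+-suc k (length qs)) k+|qs|≤L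

  -- The input variable has the root type t-r, so (In) holds by its first alternative.
  inp-stratified : ∀ k q {P L} → k ≤ ℓ → k < L → StratifiedBelow (c L zero) P
                 → StratifiedBelow (c L zero) (seq (inp (c k q) dummy ∙ P))
  inp-stratified k q {P} k≤ℓ k<L (S , below) = seq-strat (inp-strat (ty-c k q) t-r≤t-c S) , below'
    where
    t-r≤t-c : _≤ᵀ_ forest t-r (t-c k q)
    t-r≤t-c = inj₂ (subst (λ τ → t-r ⊏ baseOf τ) (ty-c k q)
                 (⊏-by-name {1} (s≤s (s≤s z≤n)) (s≤s (s≤s z≤n)) (c-< q (s≤s k≤ℓ))))
    below' : FnBelow _ (seq (inp (c k q) dummy ∙ P))
    below' (here refl) = c-< q k<L
    below' (there z∈) = below (proj₁ (∈-remove⁻ _ z∈))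

  inpChain-stratified : ∀ k {m} (qs : Vec (Fin n) (suc m)) {P L} → k + m ≤ ℓ → k + m < L
                      → StratifiedBelow (c L zero) P → StratifiedBelow (c L zero) (seq (inpChain k qs P))
  inpChain-stratified k {zero} (q ∷ᵥ []ᵥ) k+0≤ℓ k+0<L body =
    inp-stratified k q (≤-trans (m≤m+n k 0) k+0≤ℓ) (≤-<-trans (m≤m+n k 0) k+0<L) body
  inpChain-stratified k {suc m} (q ∷ᵥ q' ∷ᵥ qs) {L = L} k+m≤ℓ k+m<L body =
    inp-stratified k q (≤-trans (m≤m+n k (suc m)) k+m≤ℓ) (≤-<-trans (m≤m+n k (suc m)) k+m<L)
      (inpChain-stratified (suc k) (q' ∷ᵥ qs) (subst (_≤ ℓ) (+-suc k m) k+m≤ℓ)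
        (subst (_< L) (+-suc k m) k+m<L) body)

  Pθ-component : ∀ f k → Component (c (suc k) zero) (Pθ f k)
  bangs-components : ∀ f k trs → All (λ tr → Trans.j tr ≡ k) trs
                   → All (Component (c (suc k) zero)) (bangs f trs)
  Atr-stratified : ∀ f tr → StratifiedBelow (c (suc (Trans.j tr)) zero) (seq (Atr f tr))
  Pθs-components : ∀ f i ks → All (_< suc i) ks → All (Component (c (suc i) zero)) (Pθs f ks)
  Pθ-component zero k = prod-component [] []
  Pθ-component (suc f) k =
    prod-component _ (bangs-components f k _ (all-filter (λ tr → Trans.j tr ≟ k) δ))
  bangs-components f k [] [] = []
  bangs-components f k (tr ∷ trs) (refl ∷ js≡k) =
    bang-component (Atr-stratified f tr) ∷ bangs-components f k trs js≡k
  Atr-stratified f tr =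
    inpChain-stratified 0 src (≤-trans j≤i i≤ℓ) ≤-refl
      (νC-stratified (consecutive-levels j≤i) (s≤s i≤ℓ) (proj₂ (∥-component
        (prod-component _ (outs-components 0 (toList tgt) (suc i) (≤-reflexive (length-toList tgt))))
        (prod-component _ (Pθs-components f i (levels j i) (consecutive-< (consecutive-levels j≤i)))))))
    where open Trans tr
  Pθs-components f i [] [] = []
  Pθs-components f i (k ∷ ks) (k<1+i ∷ ks<1+i) =
    component-≤ (c-≤ k<1+i) (Pθ-component f k) ∷ Pθs-components f i ks ks<1+i

  𝒫-stratified : StratifiedBelow 2 𝒫
  𝒫-stratified = νC-stratified (next refl done) (s≤s z≤n)
    (proj₂ (∥-component (Pθ-component (suc ℓ) 0) (outbar-component 0 q₀ (c-< {L = 1} q₀ (s≤s z≤n)))))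

  -- dummy is never free in 𝒫, but FnBelow 2 does not exclude it.
  Γ₀ : Env n
  Γ₀ = (r , base t-r) ∷ (dummy , base t-r) ∷ []

  Γ₀-root : ∀ y {σ} → lookupEnv Γ₀ y ≡ just σ → baseOf σ ≡ t-r
  Γ₀-root 0 refl = refl
  Γ₀-root 1 refl = refl

  Γ₀-over : EnvOver forest Γ₀
  Γ₀-over _ _ (here refl) = decode-∈ z≤n
  Γ₀-over _ _ (there (here refl)) = decode-∈ z≤n

  fresh₀ : ℕ
  fresh₀ = suc (foldr _⊔_ 0 (namesP 𝒫))

  tracks₀ : Tracks id Γ₀ fresh₀ (fnP 𝒫)
  tracks₀ = record { typed-renaming = typed ; dom<fresh = bounded }
    where
    typed : ∀ {z} → z ∈ fnP 𝒫 → lookupEnv Γ₀ z ≡ just (ty z)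
    typed {0} _ = refl
    typed {1} _ = refl
    typed {suc (suc _)} z∈ = contradiction (s≤s⁻¹ (s≤s⁻¹ (proj₂ 𝒫-stratified z∈))) n≮0
    bounded : ∀ {y σ} → lookupEnv Γ₀ y ≡ just σ → y < fresh₀
    bounded {0} _ = s≤s z≤n
    bounded {1} _ = s≤s (≤-trans (s≤s z≤n) (∈⇒≤max {xs = namesP 𝒫} (here refl)))

  nf-𝒫-typed : StronglyTyped Γ₀ (nf 𝒫) × Chained forest t-r (nf 𝒫)
  nf-𝒫-typed = nfP-typed (proj₁ 𝒫-stratified) id fresh₀ Γ₀ tracks₀

theorem6 : (ℓ : ℕ) (𝒜 : NDCMA ℓ)
    → (∀ d → NDCMA.f₀ 𝒜 d ≡ nothing)
    → TypablyHierarchical 𝒜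
theorem6 ℓ record { n = zero ; q₀ = () } _
theorem6 ℓ record { n = suc n' ; δ = δ ; q₀ = q₀ ; f₀ = f₀ } _ =
  forest , (decode-∈ z≤n , λ i q i≤ℓ → t-c-∈ i q (rank≤size i q i≤ℓ)) ,
  shaped-nf forest (nf 𝒫) (proj₂ nf-𝒫-typed) ,
  Γ₀ , Γ₀-over , chained-safe forest {Γ = Γ₀} (nf 𝒫) Γ₀-root (proj₂ nf-𝒫-typed) ,
  stronglyTyped⇒⊢N (nf 𝒫) (proj₁ nf-𝒫-typed)
  where
  open StratifiedEncoding n' ℓ δ q₀ f₀
  open Encoding 𝒜 using (𝒫)
  open LevelChain (suc n') ℓ
  open Stratification forest ty t-r using (stronglyTyped⇒⊢N)
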